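{- Let $K$ be a complete discrete valuation field of characteristic $p=2$ and let $s\ge1$. Then $V^{s-1}:K=W_1(K)\to W_s(K)$ induces an isomorphism $\mathrm{gr}'_2K\to\mathrm{gr}'_2W_s(K)$.
   Context: $W_s(K)$: Witt vectors of length $s$ written $(a_{s-1},\dots,a_0)$ with $a_{s-1}$ the first (classical $0$-th) component; $V(a_{s-1},\dots,a_0)=(0,a_{s-1},\dots,a_0)$. With $\mathrm{ord}_K$ the normalized valuation, $\mathrm{ord}_K(a)=\min_ip^i\mathrm{ord}_K(a_i)$, $\mathrm{fil}_nW_s(K)=\{a:\mathrm{ord}_K(a)\ge-n\}$ ($n\in\mathbf{Z}$). For $m\ge1$ and $s'=\min\{\mathrm{ord}_p(m),s\}$, $\mathrm{fil}'_mW_s(K)=\mathrm{fil}_{m-1}W_s(K)+V^{s-s'}\mathrm{fil}_mW_{s'}(K)$, and $\mathrm{gr}'_m=\mathrm{fil}'_m/\mathrm{fil}'_{m-1}$ for $m\ge2$. -}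

module Defs where

open import Level using (Level; _⊔_)
open import Data.Nat as ℕ using (ℕ; zero; suc; _⊓_; _∸_)
import Data.Nat.Properties as ℕP
open import Data.Integer as ℤ using (ℤ; +_; -[1+_])
import Data.Integer.Properties as ℤP
open import Data.Maybe using (Maybe; just; nothing)
open import Data.List using (List; []; _∷_; _++_; foldr; map; concatMap; replicate; upTo)
open import Data.List.Properties using (≡-dec)
open import Data.Vec as Vec using (Vec; []; _∷_; lookup; tabulate; cast)
open import Data.Vec.Relation.Binary.Pointwise.Inductive using (Pointwise)
open import Data.Fin using (Fin; toℕ)
open import Data.Product using (Σ; _×_; _,_; ∃; ∃-syntax)
open import Data.Bool using (if_then_else_)
open import Data.Unit.Polymorphic using (⊤)
open import Data.Empty.Polymorphic using (⊥)
open import Relation.Nullary using (¬_; yes; no; does)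
open import Relation.Binary.PropositionalEquality using (_≡_)
open import Algebra.Bundles using (CommutativeRing)

-- A monomial is a list of exponents [e₀, e₁, …] (variable k has exponent eₖ,
-- missing entries are 0); a polynomial is a list of (monomial , coefficient)
-- with pairwise distinct monomials and nonzero coefficients.

Mono : Set
Mono = List ℕ

mmul : Mono → Mono → Mono
mmul []       ys       = ys
mmul xs       []       = xs
mmul (x ∷ xs) (y ∷ ys) = (x ℕ.+ y) ∷ mmul xs ys

Poly : Set
Poly = List (Mono × ℤ)

ins : Mono × ℤ → Poly → Poly
ins (m , c) [] = if does (c ℤP.≟ + 0) then [] else (m , c) ∷ []
ins (m , c) ((m' , c') ∷ ps) =
  if does (≡-dec ℕP._≟_ m m')
  then (if does ((c ℤ.+ c') ℤP.≟ + 0) then ps else (m , c ℤ.+ c') ∷ ps)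
  else (m' , c') ∷ ins (m , c) ps

norm : Poly → Poly
norm = foldr ins []

pconst : ℤ → Poly
pconst c = norm ((([] , c)) ∷ [])

pvar : ℕ → Poly
pvar k = (replicate k 0 ++ (1 ∷ []) , + 1) ∷ []

padd : Poly → Poly → Poly
padd p q = norm (p ++ q)

pscale : ℤ → Poly → Poly
pscale c p = norm (map (λ { (m , d) → (m , c ℤ.* d) }) p)

psub : Poly → Poly → Poly
psub p q = padd p (pscale (ℤ.- (+ 1)) q)

pmul : Poly → Poly → Poly
pmul p q = norm (concatMap (λ { (m , c) → map (λ { (m' , c') → (mmul m m' , c ℤ.* c') }) q }) p)

ppow : Poly → ℕ → Poly
ppow p zero    = pconst (+ 1)
ppow p (suc k) = pmul p (ppow p k)

psum : List Poly → Poly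
psum = foldr padd []

-- halving of an integer (exact on even integers)
halve : ℤ → ℤ
halve (+ n)     = + (n ℕ./ 2)
halve -[1+ n ]  = ℤ.- (+ (suc n ℕ./ 2))

-- divide all coefficients by 2^n (exact in the use below)
pdiv2^ : ℕ → Poly → Poly
pdiv2^ zero    p = p
pdiv2^ (suc n) p = pdiv2^ n (norm (map (λ { (m , c) → (m , halve c) }) p))

nth : List Poly → ℕ → Poly
nth []       _       = []
nth (p ∷ ps) zero    = p
nth (p ∷ ps) (suc k) = nth ps k

-- Witt addition polynomials for p = 2.
-- Variables: X_i = variable 2i, Y_i = variable 2i+1.
-- S_n is determined by the ghost-component identities
--   Σ_{i≤n} 2^i S_i^{2^{n-i}} = Σ_{i≤n} 2^i (X_i^{2^{n-i}} + Y_i^{2^{n-i}}),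
-- i.e. S_n = 2^{-n}( Σ_{i≤n} 2^i (X_i^{2^{n-i}}+Y_i^{2^{n-i}})
--                    - Σ_{i<n} 2^i S_i^{2^{n-i}} ).

pX pY : ℕ → Poly
pX i = pvar (2 ℕ.* i)
pY i = pvar (suc (2 ℕ.* i))

ghostXY : ℕ → Poly
ghostXY n = psum (map (λ i → pscale (+ (2 ℕ.^ i))
                     (padd (ppow (pX i) (2 ℕ.^ (n ∸ i))) (ppow (pY i) (2 ℕ.^ (n ∸ i)))))
                   (upTo (suc n)))

-- SList n = [S_0 , … , S_{n-1}]
SList : ℕ → List Poly
SList zero    = []
SList (suc n) = SList n ++ (Snew ∷ [])
  where
  L = SList n
  corr = psum (map (λ i → pscale (+ (2 ℕ.^ i)) (ppow (nth L i) (2 ℕ.^ (n ∸ i)))) (upTo n))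
  Snew = pdiv2^ n (psub (ghostXY n) corr)

S : ℕ → Poly
S n = nth (SList (suc n)) n

-- Extended integers ℤ ∪ {∞} as Maybe ℤ (nothing = +∞)

_≤∞_ : Maybe ℤ → Maybe ℤ → Set
_        ≤∞ nothing = ⊤
nothing  ≤∞ just _  = ⊥
just a   ≤∞ just b  = a ℤ.≤ b

_+∞_ : Maybe ℤ → Maybe ℤ → Maybe ℤ
nothing +∞ _       = nothing
just _  +∞ nothing = nothing
just a  +∞ just b  = just (a ℤ.+ b)

min∞ : Maybe ℤ → Maybe ℤ → Maybe ℤ
min∞ nothing  y        = y
min∞ (just a) nothing  = just a
min∞ (just a) (just b) = just (a ℤ.⊓ b)

_≥∞_ : Maybe ℤ → ℤ → Set
x ≥∞ N = just N ≤∞ x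

-- "w · x ≥ N" for x ∈ ℤ ∪ {∞}, w ∈ ℕ (w·∞ = ∞)
scaled≥ : ℕ → Maybe ℤ → ℤ → Set
scaled≥ w nothing  N = ⊤
scaled≥ w (just k) N = N ℤ.≤ (+ w) ℤ.* k

-- 2-adic valuation of a natural number (ord₂ 0 := 0, never used)
ord₂-fuel : ℕ → ℕ → ℕ
ord₂-fuel zero    m = 0
ord₂-fuel (suc f) zero = 0
ord₂-fuel (suc f) (suc m) =
  if does ((suc m ℕ.% 2) ℕP.≟ 0) then suc (ord₂-fuel f (suc m ℕ./ 2)) else 0

ord₂ : ℕ → ℕ
ord₂ m = ord₂-fuel m m

module OverRing {c ℓ} (K : CommutativeRing c ℓ) where
  open CommutativeRing K

  fromℕ : ℕ → Carrier
  fromℕ zero    = 0#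
  fromℕ (suc n) = 1# + fromℕ n

  fromℤ : ℤ → Carrier
  fromℤ (+ n)    = fromℕ n
  fromℤ -[1+ n ] = - fromℕ (suc n)

  _^K_ : Carrier → ℕ → Carrier
  x ^K zero    = 1#
  x ^K (suc n) = x * (x ^K n)

  evalMono : Mono → (ℕ → Carrier) → Carrier
  evalMono []       env = 1#
  evalMono (e ∷ es) env = (env 0 ^K e) * evalMono es (λ k → env (suc k))

  evalPoly : Poly → (ℕ → Carrier) → Carrier
  evalPoly []             env = 0#
  evalPoly ((m , a) ∷ ps) env = fromℤ a * evalMono m env + evalPoly ps env

  -- Witt vectors of length s: W s = Vec Carrier s in CLASSICAL order
  -- (x₀ , … , x_{s-1}); in the paper's notation (a_{s-1},…,a₀) this is
  -- a_{s-1} = x₀, …, a₀ = x_{s-1}, i.e. a_i = x_{s-1-i}.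
  W : ℕ → Set c
  W s = Vec Carrier s

  at : ∀ {s} → W s → ℕ → Carrier
  at []       _       = 0#
  at (x ∷ xs) zero    = x
  at (x ∷ xs) (suc k) = at xs k

  envXY : (ℕ → Carrier) → (ℕ → Carrier) → ℕ → Carrier
  envXY f g zero          = f 0
  envXY f g (suc zero)    = g 0
  envXY f g (suc (suc k)) = envXY (λ i → f (suc i)) (λ i → g (suc i)) k

  -- Witt vector addition (valid Witt addition when char K = 2)
  _+W_ : ∀ {s} → W s → W s → W s
  _+W_ {s} x y = tabulate (λ j → evalPoly (S (toℕ j)) (envXY (at x) (at y)))

  _≋_ : ∀ {s} → W s → W s → Set (c ⊔ ℓ)
  _≋_ = Pointwise _≈_

  V : ∀ {s} → W s → W (suc s)
  V x = 0# ∷ x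

  Vpow : ∀ k {s} → W s → W (k ℕ.+ s)
  Vpow zero    x = x
  Vpow (suc k) x = V (Vpow k x)

  Vto : ∀ k s → k ℕ.≤ s → W k → W s
  Vto k s h x = cast (ℕP.m∸n+n≡m h) (Vpow (s ∸ k) x)

  asW1 : Carrier → W 1
  asW1 a = a ∷ []

  record IsField : Set (c ⊔ ℓ) where
    field
      1≉0 : ¬ (1# ≈ 0#)
      inverse : ∀ x → ¬ (x ≈ 0#) → ∃[ y ] (x * y ≈ 1#)

  CharTwo : Set ℓ
  CharTwo = 1# + 1# ≈ 0#

  record IsNormalizedDiscreteValuation (ord : Carrier → Maybe ℤ) : Set (c ⊔ ℓ) where
    field
      ord-cong  : ∀ {x y} → x ≈ y → ord x ≡ ord y
      ord-∞⇒0   : ∀ x → ord x ≡ nothing → x ≈ 0#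
      ord-0⇒∞   : ∀ x → x ≈ 0# → ord x ≡ nothing
      ord-mul   : ∀ x y → ord (x * y) ≡ ord x +∞ ord y
      ord-add   : ∀ x y → min∞ (ord x) (ord y) ≤∞ ord (x + y)
      ord-surj  : ∀ (k : ℤ) → ∃[ x ] (ord x ≡ just k)

  IsCauchy : (Carrier → Maybe ℤ) → (ℕ → Carrier) → Set
  IsCauchy ord a = ∀ (N : ℤ) → ∃[ M ] (∀ m n → M ℕ.≤ m → M ℕ.≤ n → ord (a m - a n) ≥∞ N)

  ConvergesTo : (Carrier → Maybe ℤ) → (ℕ → Carrier) → Carrier → Set
  ConvergesTo ord a L = ∀ (N : ℤ) → ∃[ M ] (∀ n → M ℕ.≤ n → ord (a n - L) ≥∞ N)

  IsComplete : (Carrier → Maybe ℤ) → Set c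
  IsComplete ord = ∀ (a : ℕ → Carrier) → IsCauchy ord a → ∃[ L ] ConvergesTo ord a L

  module Filtrations (ord : Carrier → Maybe ℤ) where

    -- a ∈ fil_n W_s(K)  iff  ord_K(a) = min_i 2^i ord_K(a_i) ≥ -n,
    -- with a_i = x_{s-1-i} (classical component index j has weight 2^{s-1-j})
    Fil : ∀ {s} → ℤ → W s → Set
    Fil {s} n x = ∀ (j : Fin s) → scaled≥ (2 ℕ.^ (s ∸ suc (toℕ j))) (ord (lookup x j)) (ℤ.- n)

    s′ : ℕ → ℕ → ℕ
    s′ m s = ord₂ m ⊓ s

    Fil′ : ∀ {s} → ℕ → W s → Set (c ⊔ ℓ)
    Fil′ {s} m x =
      Σ (W s) λ y → Σ (W (s′ m s)) λ z →
        Fil (+ m ℤ.- + 1) y × Fil (+ m) z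
        × (x ≋ (y +W Vto (s′ m s) s (ℕP.m⊓n≤n (ord₂ m) s) z))

    CongMod : ∀ {s} → ℕ → W s → W s → Set (c ⊔ ℓ)
    CongMod {s} k x y = Σ (W s) λ b → Fil′ k b × (y ≋ (x +W b))

    -- f : W_r(K) → W_s(K) induces an isomorphism of groups
    --   gr'_m W_r(K) = fil'_m/fil'_{m-1}  →  gr'_m W_s(K)     (m ≥ 2)
    record InducesIsoOnGr′ {r s} (m : ℕ) (f : W r → W s) : Set (c ⊔ ℓ) where
      field
        maps-fil     : ∀ a → Fil′ m a → Fil′ m (f a)
        well-defined : ∀ a a′ → Fil′ m a → Fil′ m a′ →
                       CongMod (m ∸ 1) a a′ → CongMod (m ∸ 1) (f a) (f a′)
        additive     : ∀ a a′ → Fil′ m a → Fil′ m a′ →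
                       CongMod (m ∸ 1) (f (a +W a′)) (f a +W f a′)
        injective    : ∀ a a′ → Fil′ m a → Fil′ m a′ →
                       CongMod (m ∸ 1) (f a) (f a′) → CongMod (m ∸ 1) a a′
        surjective   : ∀ x → Fil′ m x → Σ (W r) λ a → Fil′ m a × CongMod (m ∸ 1) (f a) x

module Submission where

-- Since ord₂ 2 = 1,  fil'_2 W_s = fil_1 W_s + V^{s-1} fil_2 K  and  fil'_1 W_s = fil_0 W_s.
-- In fil_1 W_s every component but the last has weight 2^i ≥ 2 and so already satisfies
-- the fil_0 bound; modulo fil_0 only the last component matters, and V^{s-1} puts a ∈ K
-- exactly there.  The only property of Witt addition this needs is
--   (*)  if x_i = 0 for all i < j, or y_i = 0 for all i < j, then (x + y)_j = x_j + y_j.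
-- Witt addition is given by the integral polynomials S_n of Defs, so (*) amounts to:
-- deleting from S_n every monomial containing one of X₀,…,X_{n-1} (or Y₀,…,Y_{n-1})
-- leaves X_n + Y_n.

open import Defs
open import Level using (Level)
open import Data.Nat using (ℕ; _≤_; _∸_)
open import Data.Integer using (ℤ)
open import Data.Maybe using (Maybe)
open import Algebra.Bundles using (CommutativeRing)

open import Algebra.Bundles using (CommutativeMonoid)
open import Data.Nat as ℕ using (zero; suc; _<_; s≤s; z≤n)
import Data.Nat.Properties as ℕP
import Data.Nat.DivMod as ℕD
open import Data.Nat.Induction using (<-rec)
open import Data.Integer as ℤ using (+_; -[1+_])
import Data.Integer.Properties as ℤP
open import Data.Integer.Tactic.RingSolver using (solve-∀)
open import Data.Maybe using (just; nothing)
open import Data.List using ([]; _∷_; _++_; _∷ʳ_; map; concatMap; replicate; upTo; length)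
import Data.List.Properties as ListP
open import Data.List.Properties using (≡-dec; upTo-∷ʳ)
open import Data.List.Relation.Unary.All using (All; []; _∷_)
open import Data.Bool using (Bool; true; false; if_then_else_; _∧_)
open import Data.Bool.Properties using (∧-identityʳ; ∧-zeroʳ; ∧-commutativeMonoid)
open import Algebra.Properties.CommutativeSemigroup
  (CommutativeMonoid.commutativeSemigroup ∧-commutativeMonoid) using (interchange)
open import Data.Vec as Vec using ([]; _∷_; lookup; tabulate)
import Data.Vec.Properties as VecP
import Data.Vec.Relation.Binary.Pointwise.Inductive as Pointwise
import Data.Vec.Relation.Binary.Pointwise.Extensional as Extensional
open import Data.Fin as Fin using (Fin; toℕ)
import Data.Fin.Properties as FinP
open import Data.Product using (Σ; _×_; _,_; proj₁; proj₂)
open import Data.Sum using (_⊎_; inj₁; inj₂)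
open import Data.Unit.Polymorphic using (⊤; tt)
open import Data.Empty using (⊥-elim)
open import Function using (_∘_)
open import Relation.Nullary using (¬_; yes; no; does)
open import Relation.Binary.PropositionalEquality as ≡ using (_≡_; module ≡-Reasoning)

-- Pairing a polynomial with a weight g on monomials,
--   ⟨ g ∣ p ⟩ = Σ c · g m   over the terms (m , c) of p,
-- ignores how p is stored, so it is additive and blind to `norm`.  Two polynomials
-- with the same pairing against every weight have the same coefficients (_≈ₚ_),
-- and all ring operations of Defs respect this relation.
module Coefficients where
  open ≡ using (refl; sym; trans; cong; cong₂)

  term : (Mono → ℤ) → Mono × ℤ → ℤ
  term g (m , c) = c ℤ.* g m

  sumTerms : (Mono × ℤ → ℤ) → Poly → ℤ
  sumTerms h []       = + 0
  sumTerms h (t ∷ ps) = h t ℤ.+ sumTerms h ps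

  ⟨_∣_⟩ : (Mono → ℤ) → Poly → ℤ
  ⟨ g ∣ p ⟩ = sumTerms (term g) p

  sumTerms-cong : ∀ {h h′} → (∀ t → h t ≡ h′ t) → ∀ p → sumTerms h p ≡ sumTerms h′ p
  sumTerms-cong eq []      = refl
  sumTerms-cong eq (t ∷ p) = cong₂ ℤ._+_ (eq t) (sumTerms-cong eq p)

  sumTerms-++ : ∀ h p q → sumTerms h (p ++ q) ≡ sumTerms h p ℤ.+ sumTerms h q
  sumTerms-++ h []      q = sym (ℤP.+-identityˡ _)
  sumTerms-++ h (t ∷ p) q =
    trans (cong (λ r → h t ℤ.+ r) (sumTerms-++ h p q)) (sym (ℤP.+-assoc (h t) _ _))

  sumTerms-map : ∀ h F p → sumTerms h (map F p) ≡ sumTerms (h ∘ F) p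
  sumTerms-map h F []      = refl
  sumTerms-map h F (t ∷ p) = cong (λ r → h (F t) ℤ.+ r) (sumTerms-map h F p)

  sumTerms-concatMap : ∀ h F p → sumTerms h (concatMap F p) ≡ sumTerms (sumTerms h ∘ F) p
  sumTerms-concatMap h F []      = refl
  sumTerms-concatMap h F (t ∷ p) =
    trans (sumTerms-++ h (F t) (concatMap F p))
          (cong (λ r → sumTerms h (F t) ℤ.+ r) (sumTerms-concatMap h F p))

  sumTerms-scale : ∀ c h p → sumTerms (λ t → c ℤ.* h t) p ≡ c ℤ.* sumTerms h p
  sumTerms-scale c h []      = sym (ℤP.*-zeroʳ c)
  sumTerms-scale c h (t ∷ p) =
    trans (cong (λ r → c ℤ.* h t ℤ.+ r) (sumTerms-scale c h p)) (sym (ℤP.*-distribˡ-+ c (h t) _))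

  pairing-cong : ∀ {g g′} → (∀ m → g m ≡ g′ m) → ∀ p → ⟨ g ∣ p ⟩ ≡ ⟨ g′ ∣ p ⟩
  pairing-cong eq = sumTerms-cong λ { (m , c) → cong (c ℤ.*_) (eq m) }

  merge-terms : ∀ a b x r → (a ℤ.+ b) ℤ.* x ℤ.+ r ≡ a ℤ.* x ℤ.+ (b ℤ.* x ℤ.+ r)
  merge-terms = solve-∀

  swap-terms : ∀ a x b y r → b ℤ.* y ℤ.+ (a ℤ.* x ℤ.+ r) ≡ a ℤ.* x ℤ.+ (b ℤ.* y ℤ.+ r)
  swap-terms = solve-∀

  pairing-ins : ∀ g m c ps → ⟨ g ∣ ins (m , c) ps ⟩ ≡ c ℤ.* g m ℤ.+ ⟨ g ∣ ps ⟩
  pairing-ins g m c [] with c ℤP.≟ + 0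
  ... | yes refl = refl
  ... | no _     = refl
  pairing-ins g m c ((m′ , c′) ∷ ps) with ≡-dec ℕP._≟_ m m′
  ... | no _ = trans (cong (λ r → c′ ℤ.* g m′ ℤ.+ r) (pairing-ins g m c ps))
                     (swap-terms c (g m) c′ (g m′) ⟨ g ∣ ps ⟩)
  ... | yes refl with (c ℤ.+ c′) ℤP.≟ + 0
  ...   | no _       = merge-terms c c′ (g m) ⟨ g ∣ ps ⟩
  ...   | yes c+c′≡0 = begin
    ⟨ g ∣ ps ⟩                                   ≡⟨ sym (ℤP.+-identityˡ _) ⟩
    + 0 ℤ.* g m ℤ.+ ⟨ g ∣ ps ⟩                   ≡⟨ cong (λ a → a ℤ.* g m ℤ.+ ⟨ g ∣ ps ⟩) (sym c+c′≡0) ⟩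
    (c ℤ.+ c′) ℤ.* g m ℤ.+ ⟨ g ∣ ps ⟩            ≡⟨ merge-terms c c′ (g m) ⟨ g ∣ ps ⟩ ⟩
    c ℤ.* g m ℤ.+ (c′ ℤ.* g m ℤ.+ ⟨ g ∣ ps ⟩)    ∎
    where open ≡-Reasoning

  pairing-norm : ∀ g p → ⟨ g ∣ norm p ⟩ ≡ ⟨ g ∣ p ⟩
  pairing-norm g []            = refl
  pairing-norm g ((m , c) ∷ p) =
    trans (pairing-ins g m c (norm p)) (cong (λ r → c ℤ.* g m ℤ.+ r) (pairing-norm g p))

  pairing-padd : ∀ g p q → ⟨ g ∣ padd p q ⟩ ≡ ⟨ g ∣ p ⟩ ℤ.+ ⟨ g ∣ q ⟩
  pairing-padd g p q = trans (pairing-norm g (p ++ q)) (sumTerms-++ (term g) p q)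

  pairing-pscale : ∀ g c p → ⟨ g ∣ pscale c p ⟩ ≡ c ℤ.* ⟨ g ∣ p ⟩
  pairing-pscale g c p =
    trans (pairing-norm g (map scaled p))
    (trans (sumTerms-map (term g) scaled p)
    (trans (sumTerms-cong (λ { (m , d) → ℤP.*-assoc c d (g m) }) p)
           (sumTerms-scale c (term g) p)))
    where
    scaled : Mono × ℤ → Mono × ℤ
    scaled t = proj₁ t , c ℤ.* proj₂ t

  pairing-psub : ∀ g p q → ⟨ g ∣ psub p q ⟩ ≡ ⟨ g ∣ p ⟩ ℤ.+ ℤ.- (+ 1) ℤ.* ⟨ g ∣ q ⟩
  pairing-psub g p q =
    trans (pairing-padd g p _) (cong (λ r → ⟨ g ∣ p ⟩ ℤ.+ r) (pairing-pscale g (ℤ.- (+ 1)) q))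

  pairing-pmul : ∀ g p q → ⟨ g ∣ pmul p q ⟩ ≡ ⟨ (λ m → ⟨ g ∘ mmul m ∣ q ⟩) ∣ p ⟩
  pairing-pmul g p q =
    trans (pairing-norm g (concatMap timesQ p))
    (trans (sumTerms-concatMap (term g) timesQ p)
           (sumTerms-cong (λ { (m , c) →
              trans (sumTerms-map (term g) (times (m , c)) q)
              (trans (sumTerms-cong (λ { (m′ , c′) → ℤP.*-assoc c c′ (g (mmul m m′)) }) q)
                     (sumTerms-scale c (term (g ∘ mmul m)) q)) }) p))
    where
    times : Mono × ℤ → Mono × ℤ → Mono × ℤ
    times t t′ = mmul (proj₁ t) (proj₁ t′) , proj₂ t ℤ.* proj₂ t′
    timesQ : Mono × ℤ → Poly
    timesQ t = map (times t) q

  sumTo : (ℕ → ℤ) → ℕ → ℤ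
  sumTo f zero    = + 0
  sumTo f (suc n) = sumTo f n ℤ.+ f n

  pairing-psum-snoc : ∀ g (F : ℕ → Poly) is i →
    ⟨ g ∣ psum (map F (is ∷ʳ i)) ⟩ ≡ ⟨ g ∣ psum (map F is) ⟩ ℤ.+ ⟨ g ∣ F i ⟩
  pairing-psum-snoc g F []       i =
    trans (pairing-padd g (F i) []) (trans (ℤP.+-identityʳ ⟨ g ∣ F i ⟩) (sym (ℤP.+-identityˡ ⟨ g ∣ F i ⟩)))
  pairing-psum-snoc g F (j ∷ is) i =
    trans (pairing-padd g (F j) _)
    (trans (cong (λ r → ⟨ g ∣ F j ⟩ ℤ.+ r) (pairing-psum-snoc g F is i))
    (trans (sym (ℤP.+-assoc ⟨ g ∣ F j ⟩ _ _))
           (cong (λ r → r ℤ.+ ⟨ g ∣ F i ⟩) (sym (pairing-padd g (F j) _)))))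

  pairing-psum-upTo : ∀ g (F : ℕ → Poly) n → ⟨ g ∣ psum (map F (upTo n)) ⟩ ≡ sumTo (λ i → ⟨ g ∣ F i ⟩) n
  pairing-psum-upTo g F zero    = refl
  pairing-psum-upTo g F (suc n) =
    trans (cong (λ is → ⟨ g ∣ psum (map F is) ⟩) (sym (upTo-∷ʳ n)))
    (trans (pairing-psum-snoc g F (upTo n) n)
           (cong (λ r → r ℤ.+ ⟨ g ∣ F n ⟩) (pairing-psum-upTo g F n)))

  record _≈ₚ_ (p q : Poly) : Set where
    constructor sameCoeffs
    field pairing-eq : ∀ g → ⟨ g ∣ p ⟩ ≡ ⟨ g ∣ q ⟩
  open _≈ₚ_ public

  ≈ₚ-trans : ∀ {p q r} → p ≈ₚ q → q ≈ₚ r → p ≈ₚ r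
  ≈ₚ-trans e e′ = sameCoeffs λ g → trans (pairing-eq e g) (pairing-eq e′ g)

  pmul-cong : ∀ {p p′ q q′} → p ≈ₚ p′ → q ≈ₚ q′ → pmul p q ≈ₚ pmul p′ q′
  pmul-cong {p} {p′} {q} {q′} e e′ = sameCoeffs λ g → begin
    ⟨ g ∣ pmul p q ⟩                          ≡⟨ pairing-pmul g p q ⟩
    ⟨ (λ m → ⟨ g ∘ mmul m ∣ q ⟩) ∣ p ⟩        ≡⟨ pairing-cong (λ m → pairing-eq e′ (g ∘ mmul m)) p ⟩
    ⟨ (λ m → ⟨ g ∘ mmul m ∣ q′ ⟩) ∣ p ⟩       ≡⟨ pairing-eq e _ ⟩
    ⟨ (λ m → ⟨ g ∘ mmul m ∣ q′ ⟩) ∣ p′ ⟩      ≡⟨ sym (pairing-pmul g p′ q′) ⟩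
    ⟨ g ∣ pmul p′ q′ ⟩                        ∎
    where open ≡-Reasoning

  ppow-one : ∀ p → ppow p 1 ≈ₚ p
  ppow-one p = sameCoeffs λ g →
    trans (pairing-pmul g p (ppow p 0))
          (pairing-cong (λ m → trans (ℤP.+-identityʳ _)
                              (trans (ℤP.*-identityˡ _) (cong g (mmul-identityʳ m)))) p)
    where
    mmul-identityʳ : ∀ m → mmul m [] ≡ m
    mmul-identityʳ []      = refl
    mmul-identityʳ (_ ∷ _) = refl

module Restriction where
  open ≡ using (refl; sym; trans; cong; cong₂)
  open Coefficients

  restrict : (Mono → Bool) → Poly → Poly
  restrict k []            = []
  restrict k ((m , c) ∷ p) = if k m then (m , c) ∷ restrict k p else restrict k p

  _⇂_ : (Mono → ℤ) → (Mono → Bool) → Mono → ℤ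
  (g ⇂ k) m = if k m then g m else + 0

  pairing-restrict : ∀ g k p → ⟨ g ∣ restrict k p ⟩ ≡ ⟨ g ⇂ k ∣ p ⟩
  pairing-restrict g k []            = refl
  pairing-restrict g k ((m , c) ∷ p) with k m
  ... | true  = cong (λ r → c ℤ.* g m ℤ.+ r) (pairing-restrict g k p)
  ... | false = trans (pairing-restrict g k p)
                      (sym (trans (cong (λ a → a ℤ.+ ⟨ g ⇂ k ∣ p ⟩) (ℤP.*-zeroʳ c)) (ℤP.+-identityˡ _)))

  restrict-restrict : ∀ k₁ k₂ → (∀ m → k₁ m ≡ true → k₂ m ≡ true) → ∀ p →
    restrict k₁ (restrict k₂ p) ≡ restrict k₁ p
  restrict-restrict k₁ k₂ k₁⇒k₂ []            = refl
  restrict-restrict k₁ k₂ k₁⇒k₂ ((m , c) ∷ p) with k₂ m in e₂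
  ... | true with k₁ m
  ...   | true  = cong ((m , c) ∷_) (restrict-restrict k₁ k₂ k₁⇒k₂ p)
  ...   | false = restrict-restrict k₁ k₂ k₁⇒k₂ p
  restrict-restrict k₁ k₂ k₁⇒k₂ ((m , c) ∷ p) | false with k₁ m in e₁
  ...   | false = restrict-restrict k₁ k₂ k₁⇒k₂ p
  ...   | true  with () ← trans (sym e₂) (k₁⇒k₂ m e₁)

  pairing-zero : ∀ p → ⟨ (λ _ → + 0) ∣ p ⟩ ≡ + 0
  pairing-zero []            = refl
  pairing-zero ((m , c) ∷ p) = cong₂ ℤ._+_ (ℤP.*-zeroʳ c) (pairing-zero p)

  ins-distinct : ∀ m c m′ c′ ps → ¬ m ≡ m′ → ins (m , c) ((m′ , c′) ∷ ps) ≡ (m′ , c′) ∷ ins (m , c) ps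
  ins-distinct m c m′ c′ ps m≢m′ with ≡-dec ℕP._≟_ m m′
  ... | yes m≡m′ = ⊥-elim (m≢m′ m≡m′)
  ... | no _     = refl

  ins-cancel : ∀ m c c′ ps → c ℤ.+ c′ ≡ + 0 → ins (m , c) ((m , c′) ∷ ps) ≡ ps
  ins-cancel m c c′ ps c+c′≡0 with ≡-dec ℕP._≟_ m m
  ... | no m≢m = ⊥-elim (m≢m refl)
  ... | yes _ with (c ℤ.+ c′) ℤP.≟ + 0
  ...   | yes _       = refl
  ...   | no c+c′≢0   = ⊥-elim (c+c′≢0 c+c′≡0)

  ins-merge : ∀ m c c′ ps → ¬ c ℤ.+ c′ ≡ + 0 → ins (m , c) ((m , c′) ∷ ps) ≡ (m , c ℤ.+ c′) ∷ ps
  ins-merge m c c′ ps c+c′≢0 with ≡-dec ℕP._≟_ m m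
  ... | no m≢m = ⊥-elim (m≢m refl)
  ... | yes _ with (c ℤ.+ c′) ℤP.≟ + 0
  ...   | yes c+c′≡0 = ⊥-elim (c+c′≢0 c+c′≡0)
  ...   | no _       = refl

  restrict-ins-kept : ∀ k m c ps → k m ≡ true → restrict k (ins (m , c) ps) ≡ ins (m , c) (restrict k ps)
  restrict-ins-kept k m c [] km with c ℤP.≟ + 0
  ... | yes _ = refl
  ... | no _ rewrite km = refl
  restrict-ins-kept k m c ((m′ , c′) ∷ ps) km with ≡-dec ℕP._≟_ m m′
  ... | yes refl with (c ℤ.+ c′) ℤP.≟ + 0
  ...   | yes c+c′≡0 rewrite km | ins-cancel m c c′ (restrict k ps) c+c′≡0 = refl
  ...   | no c+c′≢0  rewrite km | ins-merge m c c′ (restrict k ps) c+c′≢0 = refl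
  restrict-ins-kept k m c ((m′ , c′) ∷ ps) km | no m≢m′ with k m′
  ...   | true rewrite restrict-ins-kept k m c ps km | ins-distinct m c m′ c′ (restrict k ps) m≢m′ = refl
  ...   | false = restrict-ins-kept k m c ps km

  restrict-ins-dropped : ∀ k m c ps → k m ≡ false → restrict k (ins (m , c) ps) ≡ restrict k ps
  restrict-ins-dropped k m c [] km with c ℤP.≟ + 0
  ... | yes _ = refl
  ... | no _ rewrite km = refl
  restrict-ins-dropped k m c ((m′ , c′) ∷ ps) km with ≡-dec ℕP._≟_ m m′
  ... | yes refl with (c ℤ.+ c′) ℤP.≟ + 0
  ...   | yes _ rewrite km = refl
  ...   | no _  rewrite km = refl
  restrict-ins-dropped k m c ((m′ , c′) ∷ ps) km | no _ with k m′
  ...   | true rewrite restrict-ins-dropped k m c ps km = refl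
  ...   | false = restrict-ins-dropped k m c ps km

  restrict-norm : ∀ k p → restrict k (norm p) ≡ norm (restrict k p)
  restrict-norm k []            = refl
  restrict-norm k ((m , c) ∷ p) with k m in km
  ... | true  = trans (restrict-ins-kept k m c (norm p) km) (cong (ins (m , c)) (restrict-norm k p))
  ... | false = trans (restrict-ins-dropped k m c (norm p) km) (restrict-norm k p)

  halveTerm : Mono × ℤ → Mono × ℤ
  halveTerm t = proj₁ t , halve (proj₂ t)

  restrict-halve : ∀ k p → restrict k (map halveTerm p) ≡ map halveTerm (restrict k p)
  restrict-halve k []            = refl
  restrict-halve k ((m , c) ∷ p) with k m
  ... | true  = cong (halveTerm (m , c) ∷_) (restrict-halve k p)
  ... | false = restrict-halve k p

  restrict-pdiv2^ : ∀ k n p → restrict k (pdiv2^ n p) ≡ pdiv2^ n (restrict k p)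
  restrict-pdiv2^ k zero    p = refl
  restrict-pdiv2^ k (suc n) p =
    trans (restrict-pdiv2^ k n (norm (map halveTerm p)))
          (cong (pdiv2^ n) (trans (restrict-norm k (map halveTerm p)) (cong norm (restrict-halve k p))))

  Multiplicative : (Mono → Bool) → Set
  Multiplicative k = ∀ a b → k (mmul a b) ≡ k a ∧ k b

  restrict-pmul : ∀ k → Multiplicative k → ∀ p q → restrict k (pmul p q) ≈ₚ pmul (restrict k p) (restrict k q)
  restrict-pmul k mult p q = sameCoeffs λ g → begin
    ⟨ g ∣ restrict k (pmul p q) ⟩                                  ≡⟨ pairing-restrict g k (pmul p q) ⟩
    ⟨ g ⇂ k ∣ pmul p q ⟩                                           ≡⟨ pairing-pmul (g ⇂ k) p q ⟩
    ⟨ (λ m → ⟨ (g ⇂ k) ∘ mmul m ∣ q ⟩) ∣ p ⟩                      ≡⟨ pairing-cong (weight g) p ⟩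
    ⟨ (λ m → ⟨ g ∘ mmul m ∣ restrict k q ⟩) ⇂ k ∣ p ⟩             ≡⟨ sym (pairing-restrict _ k p) ⟩
    ⟨ (λ m → ⟨ g ∘ mmul m ∣ restrict k q ⟩) ∣ restrict k p ⟩
      ≡⟨ sym (pairing-pmul g (restrict k p) (restrict k q)) ⟩
    ⟨ g ∣ pmul (restrict k p) (restrict k q) ⟩                     ∎
    where
    open ≡-Reasoning
    weight : ∀ g m → ⟨ (g ⇂ k) ∘ mmul m ∣ q ⟩ ≡ ((λ m → ⟨ g ∘ mmul m ∣ restrict k q ⟩) ⇂ k) m
    weight g m with k m in km
    ... | true  = trans (pairing-cong (λ m′ → cong (λ b → if b then g (mmul m m′) else + 0)
                                                  (trans (mult m m′) (cong (_∧ k m′) km))) q)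
                        (sym (pairing-restrict (g ∘ mmul m) k q))
    ... | false = trans (pairing-cong (λ m′ → cong (λ b → if b then g (mmul m m′) else + 0)
                                                  (trans (mult m m′) (cong (_∧ k m′) km))) q)
                        (pairing-zero q)

  restrict-ppow : ∀ k → Multiplicative k → k [] ≡ true → ∀ p n → restrict k (ppow p n) ≈ₚ ppow (restrict k p) n
  restrict-ppow k mult k[] p zero    rewrite k[] = sameCoeffs λ g → refl
  restrict-ppow k mult k[] p (suc n) =
    ≈ₚ-trans (restrict-pmul k mult p (ppow p n))
             (pmul-cong {restrict k p} {restrict k p} (sameCoeffs λ g → refl) (restrict-ppow k mult k[] p n))

-- Every output of `norm` has nonzero coefficients and distinct monomials,
-- and such a polynomial is determined by its coefficients up to the order of its terms.
-- We only need this for the shape  a·m₁ + a·m₂ , and deduce: if a normal form P has the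
-- coefficients of 2ᵏ(m₁ + m₂), then pdiv2^ k P is literally m₁ + m₂ (in some order).
module NormalForms where
  open ≡ using (refl; sym; trans; cong; cong₂)
  open Coefficients
  open Restriction

  Fresh : Mono → Poly → Set
  Fresh m ps = All (λ t → ¬ m ≡ proj₁ t) ps

  NF : Poly → Set
  NF []             = ⊤
  NF ((m , c) ∷ ps) = ¬ c ≡ + 0 × Fresh m ps × NF ps

  ins-fresh : ∀ m₀ m c ps → Fresh m₀ ps → ¬ m₀ ≡ m → Fresh m₀ (ins (m , c) ps)
  ins-fresh m₀ m c [] [] m₀≢m with c ℤP.≟ + 0
  ... | yes _ = []
  ... | no _  = m₀≢m ∷ []
  ins-fresh m₀ m c ((m′ , c′) ∷ ps) (m₀≢m′ ∷ fr) m₀≢m with ≡-dec ℕP._≟_ m m′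
  ... | no _ = m₀≢m′ ∷ ins-fresh m₀ m c ps fr m₀≢m
  ... | yes refl with (c ℤ.+ c′) ℤP.≟ + 0
  ...   | yes _ = fr
  ...   | no _  = m₀≢m′ ∷ fr

  ins-NF : ∀ m c ps → NF ps → NF (ins (m , c) ps)
  ins-NF m c [] tt with c ℤP.≟ + 0
  ... | yes _   = tt
  ... | no c≢0  = c≢0 , [] , tt
  ins-NF m c ((m′ , c′) ∷ ps) (c′≢0 , fr , nf) with ≡-dec ℕP._≟_ m m′
  ... | no m≢m′ = c′≢0 , ins-fresh m′ m c ps fr (λ e → m≢m′ (sym e)) , ins-NF m c ps nf
  ... | yes refl with (c ℤ.+ c′) ℤP.≟ + 0
  ...   | yes _       = nf
  ...   | no c+c′≢0   = c+c′≢0 , fr , nf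

  norm-NF : ∀ p → NF (norm p)
  norm-NF []            = tt
  norm-NF ((m , c) ∷ p) = ins-NF m c (norm p) (norm-NF p)

  restrict-fresh : ∀ k m ps → Fresh m ps → Fresh m (restrict k ps)
  restrict-fresh k m [] [] = []
  restrict-fresh k m ((m′ , c′) ∷ ps) (m≢m′ ∷ fr) with k m′
  ... | true  = m≢m′ ∷ restrict-fresh k m ps fr
  ... | false = restrict-fresh k m ps fr

  restrict-NF : ∀ k p → NF p → NF (restrict k p)
  restrict-NF k []            tt               = tt
  restrict-NF k ((m , c) ∷ p) (c≢0 , fr , nf) with k m
  ... | true  = c≢0 , restrict-fresh k m p fr , restrict-NF k p nf
  ... | false = restrict-NF k p nf

  δ : Mono → Mono → ℤ
  δ m m′ = if does (≡-dec ℕP._≟_ m m′) then + 1 else + 0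

  coeff : Mono → Poly → ℤ
  coeff m p = ⟨ δ m ∣ p ⟩

  δ-same : ∀ m → δ m m ≡ + 1
  δ-same m with ≡-dec ℕP._≟_ m m
  ... | yes _   = refl
  ... | no m≢m  = ⊥-elim (m≢m refl)

  δ-distinct : ∀ {m m′} → ¬ m ≡ m′ → δ m m′ ≡ + 0
  δ-distinct {m} {m′} m≢m′ with ≡-dec ℕP._≟_ m m′
  ... | yes m≡m′ = ⊥-elim (m≢m′ m≡m′)
  ... | no _     = refl

  scale-δ-same : ∀ a m → a ℤ.* δ m m ≡ a
  scale-δ-same a m = trans (cong (λ r → a ℤ.* r) (δ-same m)) (ℤP.*-identityʳ a)

  scale-δ-distinct : ∀ a {m m′} → ¬ m ≡ m′ → a ℤ.* δ m m′ ≡ + 0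
  scale-δ-distinct a m≢m′ = trans (cong (λ r → a ℤ.* r) (δ-distinct m≢m′)) (ℤP.*-zeroʳ a)

  coeff-fresh : ∀ m ps → Fresh m ps → coeff m ps ≡ + 0
  coeff-fresh m [] [] = refl
  coeff-fresh m ((m′ , c′) ∷ ps) (m≢m′ ∷ fr) =
    cong₂ ℤ._+_ (scale-δ-distinct c′ m≢m′) (coeff-fresh m ps fr)

  coeff-head : ∀ m c ps → Fresh m ps → coeff m ((m , c) ∷ ps) ≡ c
  coeff-head m c ps fr =
    trans (cong₂ ℤ._+_ (scale-δ-same c m) (coeff-fresh m ps fr)) (ℤP.+-identityʳ c)

  coeff-tail : ∀ m c ps {f : Mono → ℤ} →
    (∀ m′ → coeff m′ ((m , c) ∷ ps) ≡ c ℤ.* δ m′ m ℤ.+ f m′) → ∀ m′ → coeff m′ ps ≡ f m′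
  coeff-tail m c ps {f} h m′ =
    trans (cancel (c ℤ.* δ m′ m) (coeff m′ ps))
          (trans (cong (λ r → ℤ.- (c ℤ.* δ m′ m) ℤ.+ r) (h m′)) (sym (cancel (c ℤ.* δ m′ m) (f m′))))
    where
    cancel : ∀ x r → r ≡ ℤ.- x ℤ.+ (x ℤ.+ r)
    cancel = solve-∀

  nf-zero : ∀ P → NF P → (∀ m → coeff m P ≡ + 0) → P ≡ []
  nf-zero []            tt              h = refl
  nf-zero ((m , c) ∷ P) (c≢0 , fr , _) h = ⊥-elim (c≢0 (trans (sym (coeff-head m c P fr)) (h m)))

  nf-single : ∀ m₀ a P → ¬ a ≡ + 0 → NF P → (∀ m → coeff m P ≡ a ℤ.* δ m m₀) → P ≡ (m₀ , a) ∷ []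
  nf-single m₀ a [] a≢0 tt h = ⊥-elim (a≢0 (sym (trans (h m₀) (scale-δ-same a m₀))))
  nf-single m₀ a ((m , c) ∷ P) a≢0 (c≢0 , fr , nf) h with ≡-dec ℕP._≟_ m m₀
  ... | no m≢m₀ = ⊥-elim (c≢0 (trans (sym (coeff-head m c P fr)) (trans (h m) (scale-δ-distinct a m≢m₀))))
  ... | yes refl = cong₂ (λ x R → (m , x) ∷ R) c≡a (nf-zero P nf (coeff-tail m c P λ m′ →
          trans (h m′) (trans (cong (λ x → x ℤ.* δ m′ m) (sym c≡a)) (sym (ℤP.+-identityʳ _)))))
    where
    c≡a : c ≡ a
    c≡a = trans (sym (coeff-head m c P fr)) (trans (h m) (scale-δ-same a m))

  twoTerms : Mono → Mono → ℤ → Poly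
  twoTerms m₁ m₂ a = (m₁ , a) ∷ (m₂ , a) ∷ []

  IsTwoTerms : Mono → Mono → ℤ → Poly → Set
  IsTwoTerms m₁ m₂ a P = P ≡ twoTerms m₁ m₂ a ⊎ P ≡ twoTerms m₂ m₁ a

  coeff-twoTerms : ∀ m m₁ m₂ a → coeff m (twoTerms m₁ m₂ a) ≡ a ℤ.* δ m m₁ ℤ.+ a ℤ.* δ m m₂
  coeff-twoTerms m m₁ m₂ a = cong (λ r → a ℤ.* δ m m₁ ℤ.+ r) (ℤP.+-identityʳ _)

  pairing-twoTerms-swap : ∀ g m₁ m₂ a → ⟨ g ∣ twoTerms m₂ m₁ a ⟩ ≡ ⟨ g ∣ twoTerms m₁ m₂ a ⟩
  pairing-twoTerms-swap g m₁ m₂ a = swap (a ℤ.* g m₂) (a ℤ.* g m₁)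
    where
    swap : ∀ x y → x ℤ.+ (y ℤ.+ + 0) ≡ y ℤ.+ (x ℤ.+ + 0)
    swap = solve-∀

  head-coeff-twoTerms : ∀ {m c} m₁ m₂ a P → Fresh m P →
    (∀ m′ → coeff m′ ((m , c) ∷ P) ≡ coeff m′ (twoTerms m₁ m₂ a)) → c ≡ a ℤ.* δ m m₁ ℤ.+ a ℤ.* δ m m₂
  head-coeff-twoTerms {m} {c} m₁ m₂ a P fr h =
    trans (sym (coeff-head m c P fr)) (trans (h m) (coeff-twoTerms m m₁ m₂ a))

  nf-twoTerms : ∀ m₁ m₂ a P → ¬ m₁ ≡ m₂ → ¬ a ≡ + 0 → NF P →
    (∀ m → coeff m P ≡ coeff m (twoTerms m₁ m₂ a)) → IsTwoTerms m₁ m₂ a P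
  nf-twoTerms m₁ m₂ a [] m₁≢m₂ a≢0 tt h =
    ⊥-elim (a≢0 (sym (trans (h m₁) (trans (coeff-twoTerms m₁ m₁ m₂ a)
      (trans (cong₂ ℤ._+_ (scale-δ-same a m₁) (scale-δ-distinct a m₁≢m₂)) (ℤP.+-identityʳ a))))))
  nf-twoTerms m₁ m₂ a ((m , c) ∷ P) m₁≢m₂ a≢0 (c≢0 , fr , nf) h
    with ≡-dec ℕP._≟_ m m₁ | ≡-dec ℕP._≟_ m m₂
  ... | yes refl | _ = inj₁ (cong₂ (λ x R → (m , x) ∷ R) c≡a (nf-single m₂ a P a≢0 nf (coeff-tail m c P tail)))
    where
    c≡a : c ≡ a
    c≡a = trans (head-coeff-twoTerms m₁ m₂ a P fr h)
                (trans (cong₂ ℤ._+_ (scale-δ-same a m) (scale-δ-distinct a m₁≢m₂)) (ℤP.+-identityʳ a))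
    tail : ∀ m′ → coeff m′ ((m , c) ∷ P) ≡ c ℤ.* δ m′ m ℤ.+ a ℤ.* δ m′ m₂
    tail m′ = trans (h m′) (trans (coeff-twoTerms m′ m m₂ a)
                                  (cong (λ x → x ℤ.* δ m′ m ℤ.+ a ℤ.* δ m′ m₂) (sym c≡a)))
  ... | no m≢m₁ | yes refl = inj₂ (cong₂ (λ x R → (m , x) ∷ R) c≡a (nf-single m₁ a P a≢0 nf (coeff-tail m c P tail)))
    where
    c≡a : c ≡ a
    c≡a = trans (head-coeff-twoTerms m₁ m₂ a P fr h)
                (trans (cong₂ ℤ._+_ (scale-δ-distinct a m≢m₁) (scale-δ-same a m)) (ℤP.+-identityˡ a))
    tail : ∀ m′ → coeff m′ ((m , c) ∷ P) ≡ c ℤ.* δ m′ m ℤ.+ a ℤ.* δ m′ m₁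
    tail m′ = trans (h m′) (trans (coeff-twoTerms m′ m₁ m a)
              (trans (ℤP.+-comm (a ℤ.* δ m′ m₁) (a ℤ.* δ m′ m))
                     (cong (λ x → x ℤ.* δ m′ m ℤ.+ a ℤ.* δ m′ m₁) (sym c≡a))))
  ... | no m≢m₁ | no m≢m₂ =
    ⊥-elim (c≢0 (trans (head-coeff-twoTerms m₁ m₂ a P fr h)
                       (cong₂ ℤ._+_ (scale-δ-distinct a m≢m₁) (scale-δ-distinct a m≢m₂))))

  halve-double : ∀ k → halve (+ (2 ℕ.^ suc k)) ≡ + (2 ℕ.^ k)
  halve-double k = cong +_ (trans (cong (ℕ._/ 2) (ℕP.*-comm 2 (2 ℕ.^ k))) (ℕD.m*n/n≡m (2 ℕ.^ k) 2))

  2^k≢0 : ∀ k → ¬ (+ (2 ℕ.^ k) ≡ + 0)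
  2^k≢0 k e = ℕP.<⇒≢ (ℕP.m^n>0 2 k) (sym (cong ℤ.∣_∣ e))

  halvedTwoTerms : Mono → Mono → ℕ → Poly
  halvedTwoTerms m₁ m₂ k = map halveTerm (twoTerms m₁ m₂ (+ (2 ℕ.^ suc k)))

  pdiv2^-twoTerms : ∀ m₁ m₂ → ¬ m₁ ≡ m₂ → ∀ k P → NF P →
    (∀ m → coeff m P ≡ coeff m (twoTerms m₁ m₂ (+ (2 ℕ.^ k)))) → IsTwoTerms m₁ m₂ (+ 1) (pdiv2^ k P)
  pdiv2^-twoTerms m₁ m₂ m₁≢m₂ zero P nf h = nf-twoTerms m₁ m₂ (+ 1) P m₁≢m₂ (λ ()) nf h
  pdiv2^-twoTerms m₁ m₂ m₁≢m₂ (suc k) P nf h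
    with nf-twoTerms m₁ m₂ (+ (2 ℕ.^ suc k)) P m₁≢m₂ (2^k≢0 (suc k)) nf h
  ... | inj₁ refl = pdiv2^-twoTerms m₁ m₂ m₁≢m₂ k _ (norm-NF (halvedTwoTerms m₁ m₂ k)) λ m →
          trans (pairing-norm (δ m) (halvedTwoTerms m₁ m₂ k))
                (cong (λ a → coeff m (twoTerms m₁ m₂ a)) (halve-double k))
  ... | inj₂ refl = pdiv2^-twoTerms m₁ m₂ m₁≢m₂ k _ (norm-NF (halvedTwoTerms m₂ m₁ k)) λ m →
          trans (pairing-norm (δ m) (halvedTwoTerms m₂ m₁ k))
          (trans (cong (λ a → coeff m (twoTerms m₂ m₁ a)) (halve-double k))
                 (pairing-twoTerms-swap (δ m) m₁ m₂ (+ (2 ℕ.^ k))))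

  restrict-IsTwoTerms : ∀ k m₁ m₂ a P → IsTwoTerms m₁ m₂ a P → k m₁ ≡ false → k m₂ ≡ true →
    restrict k P ≡ (m₂ , a) ∷ []
  restrict-IsTwoTerms k m₁ m₂ a _ (inj₁ refl) k₁ k₂ rewrite k₁ | k₂ = refl
  restrict-IsTwoTerms k m₁ m₂ a _ (inj₂ refl) k₁ k₂ rewrite k₁ | k₂ = refl

  IsTwoTerms-swap : ∀ {m₁ m₂ a P} → IsTwoTerms m₁ m₂ a P → IsTwoTerms m₂ m₁ a P
  IsTwoTerms-swap (inj₁ e) = inj₂ e
  IsTwoTerms-swap (inj₂ e) = inj₁ e

-- Main result: deleting from S_n every monomial that contains one of X₀,…,X_{n-1}
-- (or one of Y₀,…,Y_{n-1}) leaves exactly X_n + Y_n.  By strong induction on n: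
-- restrict the ghost identity  Σ_{i≤n} 2ⁱ S_i^{2^{n-i}} = Σ_{i≤n} 2ⁱ (X_i^{2^{n-i}} + Y_i^{2^{n-i}})
-- to such monomials; by induction each S_i (i < n) becomes the surviving variable of
-- {X_i , Y_i}, so the terms with i < n cancel and 2ⁿ S_n becomes 2ⁿ (X_n + Y_n).
module WittAdditionPolynomials where
  open ≡ using (refl; sym; trans; cong; cong₂; subst)
  open Coefficients
  open Restriction
  open NormalForms

  data Side : Set where
    X Y : Side

  other : Side → Side
  other X = Y
  other Y = X

  var : Side → ℕ → ℕ
  var X i = 2 ℕ.* i
  var Y i = suc (2 ℕ.* i)

  varMono : ℕ → Mono
  varMono k = replicate k 0 ++ 1 ∷ []

  varMono-injective : ∀ a b → varMono a ≡ varMono b → a ≡ b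
  varMono-injective zero    zero    e = refl
  varMono-injective (suc a) (suc b) e = cong suc (varMono-injective a b (ListP.∷-injectiveʳ e))
  varMono-injective zero    (suc b) ()
  varMono-injective (suc a) zero    ()

  var-other : ∀ o j i → ¬ var o j ≡ var (other o) i
  var-other X j i e = ℕP.even≢odd j i e
  var-other Y j i e = ℕP.even≢odd i j (sym e)

  var-below : ∀ o o′ {j n} → j < n → ¬ var o j ≡ var o′ n
  var-below X X j<n e = ℕP.<⇒≢ j<n (ℕP.*-cancelˡ-≡ _ _ 2 e)
  var-below Y Y j<n e = ℕP.<⇒≢ j<n (ℕP.*-cancelˡ-≡ _ _ 2 (ℕP.suc-injective e))
  var-below X Y {j} {n} _ e = ℕP.even≢odd j n e
  var-below Y X {j} {n} _ e = ℕP.even≢odd n j (sym e)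

  avoids : ℕ → Mono → Bool
  avoids k       []       = true
  avoids zero    (e ∷ es) = e ℕ.≡ᵇ 0
  avoids (suc k) (e ∷ es) = avoids k es

  avoidsBelow : Side → ℕ → Mono → Bool
  avoidsBelow o zero    m = true
  avoidsBelow o (suc n) m = avoidsBelow o n m ∧ avoids (var o n) m

  avoids-mult : ∀ k → Multiplicative (avoids k)
  avoids-mult k       []       b        = refl
  avoids-mult zero    (x ∷ xs) []       = sym (∧-identityʳ _)
  avoids-mult (suc k) (x ∷ xs) []       = sym (∧-identityʳ _)
  avoids-mult zero    (zero ∷ xs)  (y ∷ ys) = refl
  avoids-mult zero    (suc x ∷ xs) (y ∷ ys) = refl
  avoids-mult (suc k) (x ∷ xs) (y ∷ ys) = avoids-mult k xs ys

  avoidsBelow-mult : ∀ o n → Multiplicative (avoidsBelow o n)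
  avoidsBelow-mult o zero    a b = refl
  avoidsBelow-mult o (suc n) a b
    rewrite avoidsBelow-mult o n a b | avoids-mult (var o n) a b =
    interchange (avoidsBelow o n a) (avoidsBelow o n b) (avoids (var o n) a) (avoids (var o n) b)

  avoidsBelow-one : ∀ o n → avoidsBelow o n [] ≡ true
  avoidsBelow-one o zero    = refl
  avoidsBelow-one o (suc n) rewrite avoidsBelow-one o n = refl

  avoids-var : ∀ k t → ¬ k ≡ t → avoids k (varMono t) ≡ true
  avoids-var zero    zero    k≢t = ⊥-elim (k≢t refl)
  avoids-var zero    (suc t) _   = refl
  avoids-var (suc k) zero    _   = refl
  avoids-var (suc k) (suc t) k≢t = avoids-var k t (λ e → k≢t (cong suc e))

  avoids-var-self : ∀ t → avoids t (varMono t) ≡ false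
  avoids-var-self zero    = refl
  avoids-var-self (suc t) = avoids-var-self t

  avoidsBelow-var : ∀ o n t → (∀ {j} → j < n → ¬ var o j ≡ t) → avoidsBelow o n (varMono t) ≡ true
  avoidsBelow-var o zero    t h = refl
  avoidsBelow-var o (suc n) t h
    rewrite avoidsBelow-var o n t (λ j<n → h (ℕP.m<n⇒m<1+n j<n)) | avoids-var (var o n) t (h ℕP.≤-refl) = refl

  avoidsBelow-var-self : ∀ o {i n} → i < n → avoidsBelow o n (varMono (var o i)) ≡ false
  avoidsBelow-var-self o {i} {suc n} (s≤s i≤n) with ℕP.m≤n⇒m<n∨m≡n i≤n
  ... | inj₁ i<n  rewrite avoidsBelow-var-self o i<n = refl
  ... | inj₂ refl rewrite avoids-var-self (var o i) = ∧-zeroʳ _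

  avoidsBelow-mono : ∀ o {i n} m → i ≤ n → avoidsBelow o n m ≡ true → avoidsBelow o i m ≡ true
  avoidsBelow-mono o {i} {n} m i≤n e with ℕP.m≤n⇒m<n∨m≡n i≤n
  ... | inj₂ refl = e
  avoidsBelow-mono o {i} {suc n} m _ e | inj₁ (s≤s i≤n) =
    avoidsBelow-mono o m i≤n (∧-elimˡ (avoidsBelow o n m) e)
    where
    ∧-elimˡ : ∀ a {b} → a ∧ b ≡ true → a ≡ true
    ∧-elimˡ true _ = refl

  length-SList : ∀ n → length (SList n) ≡ n
  length-SList zero    = refl
  length-SList (suc n) =
    trans (ListP.length-++ (SList n)) (trans (ℕP.+-comm (length (SList n)) 1) (cong suc (length-SList n)))

  nth-++ˡ : ∀ ps q i → i < length ps → nth (ps ++ q) i ≡ nth ps i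
  nth-++ˡ (p ∷ ps) q zero    _         = refl
  nth-++ˡ (p ∷ ps) q (suc i) (s≤s i<l) = nth-++ˡ ps q i i<l

  nth-snoc : ∀ ps q n → length ps ≡ n → nth (ps ++ q ∷ []) n ≡ q
  nth-snoc []       q zero    _ = refl
  nth-snoc (p ∷ ps) q (suc n) e = nth-snoc ps q n (ℕP.suc-injective e)

  nth-SList : ∀ {n i} → i < n → nth (SList n) i ≡ S i
  nth-SList {suc n} {i} (s≤s i≤n) with ℕP.m≤n⇒m<n∨m≡n i≤n
  ... | inj₂ refl = refl
  ... | inj₁ i<n  =
    trans (nth-++ˡ (SList n) _ i (subst (i <_) (sym (length-SList n)) i<n)) (nth-SList i<n)

  ghostTerm corrTerm : ℕ → ℕ → Poly
  ghostTerm n i = pscale (+ (2 ℕ.^ i)) (padd (ppow (pX i) (2 ℕ.^ (n ∸ i))) (ppow (pY i) (2 ℕ.^ (n ∸ i))))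
  corrTerm  n i = pscale (+ (2 ℕ.^ i)) (ppow (nth (SList n) i) (2 ℕ.^ (n ∸ i)))

  ghostDiff : ℕ → Poly
  ghostDiff n = psub (ghostXY n) (psum (map (corrTerm n) (upTo n)))

  S-ghost : ∀ n → S n ≡ pdiv2^ n (ghostDiff n)
  S-ghost n = nth-snoc (SList n) _ n (length-SList n)

  Restricted : Side → ℕ → Set
  Restricted o n = IsTwoTerms (varMono (var X n)) (varMono (var Y n)) (+ 1) (restrict (avoidsBelow o n) (S n))

  restricted-sides : ∀ o n → Restricted o n →
    IsTwoTerms (varMono (var o n)) (varMono (var (other o) n)) (+ 1) (restrict (avoidsBelow o n) (S n))
  restricted-sides X n r = r
  restricted-sides Y n r = IsTwoTerms-swap r

  restrict-S-below : ∀ o {i n} → i < n → Restricted o i →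
    restrict (avoidsBelow o n) (S i) ≡ pvar (var (other o) i)
  restrict-S-below o {i} {n} i<n r =
    trans (sym (restrict-restrict (avoidsBelow o n) (avoidsBelow o i)
                  (λ m → avoidsBelow-mono o m (ℕP.<⇒≤ i<n)) (S i)))
          (restrict-IsTwoTerms (avoidsBelow o n) _ _ (+ 1) _ (restricted-sides o i r)
             (avoidsBelow-var-self o i<n)
             (avoidsBelow-var o n _ (λ _ → var-other o _ i)))

  -- every power of 2 is a successor, so a restricted variable raised to it vanishes
  2^-suc : ∀ k → Σ ℕ λ e → 2 ℕ.^ k ≡ suc e
  2^-suc k with 2 ℕ.^ k | ℕP.m^n>0 2 k
  ... | suc e | _ = e , refl

  ghost-pair : ∀ o {i n} → i < n → ∀ g e →
    ⟨ g ∣ ppow (restrict (avoidsBelow o n) (pX i)) (suc e) ⟩ ℤ.+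
    ⟨ g ∣ ppow (restrict (avoidsBelow o n) (pY i)) (suc e) ⟩
    ≡ ⟨ g ∣ ppow (pvar (var (other o) i)) (suc e) ⟩
  ghost-pair X {i} {n} i<n g e
    rewrite avoidsBelow-var-self X i<n | avoidsBelow-var X n (var Y i) (λ {j} _ → var-other X j i)
    = ℤP.+-identityˡ ⟨ g ∣ ppow (pY i) (suc e) ⟩
  ghost-pair Y {i} {n} i<n g e
    rewrite avoidsBelow-var-self Y i<n | avoidsBelow-var Y n (var X i) (λ {j} _ → var-other Y j i)
    = ℤP.+-identityʳ ⟨ g ∣ ppow (pX i) (suc e) ⟩

  module Step (o : Side) (n : ℕ) (IH : ∀ {i} → i < n → Restricted o i) (g : Mono → ℤ) where
    k : Mono → Bool
    k = avoidsBelow o n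

    pairing-restrict-ppow : ∀ p e → ⟨ g ⇂ k ∣ ppow p e ⟩ ≡ ⟨ g ∣ ppow (restrict k p) e ⟩
    pairing-restrict-ppow p e =
      trans (sym (pairing-restrict g k (ppow p e)))
            (pairing-eq (restrict-ppow k (avoidsBelow-mult o n) (avoidsBelow-one o n) p e) g)

    terms-agree : ∀ i → i < n → ⟨ g ⇂ k ∣ ghostTerm n i ⟩ ≡ ⟨ g ⇂ k ∣ corrTerm n i ⟩
    terms-agree i i<n with 2^-suc (n ∸ i)
    ... | e , d≡1+e = begin
      ⟨ g ⇂ k ∣ ghostTerm n i ⟩
        ≡⟨ pairing-pscale (g ⇂ k) 2ⁱ (padd (ppow (pX i) d) (ppow (pY i) d)) ⟩
      2ⁱ ℤ.* ⟨ g ⇂ k ∣ padd (ppow (pX i) d) (ppow (pY i) d) ⟩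
        ≡⟨ cong (2ⁱ ℤ.*_) (pairing-padd (g ⇂ k) (ppow (pX i) d) (ppow (pY i) d)) ⟩
      2ⁱ ℤ.* (⟨ g ⇂ k ∣ ppow (pX i) d ⟩ ℤ.+ ⟨ g ⇂ k ∣ ppow (pY i) d ⟩)
        ≡⟨ cong (λ d′ → 2ⁱ ℤ.* (⟨ g ⇂ k ∣ ppow (pX i) d′ ⟩ ℤ.+ ⟨ g ⇂ k ∣ ppow (pY i) d′ ⟩)) d≡1+e ⟩
      2ⁱ ℤ.* (⟨ g ⇂ k ∣ ppow (pX i) (suc e) ⟩ ℤ.+ ⟨ g ⇂ k ∣ ppow (pY i) (suc e) ⟩)
        ≡⟨ cong (2ⁱ ℤ.*_) (cong₂ ℤ._+_ (pairing-restrict-ppow (pX i) (suc e))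
                                       (pairing-restrict-ppow (pY i) (suc e))) ⟩
      2ⁱ ℤ.* (⟨ g ∣ ppow (restrict k (pX i)) (suc e) ⟩ ℤ.+ ⟨ g ∣ ppow (restrict k (pY i)) (suc e) ⟩)
        ≡⟨ cong (2ⁱ ℤ.*_) (ghost-pair o i<n g e) ⟩
      2ⁱ ℤ.* ⟨ g ∣ ppow (pvar (var (other o) i)) (suc e) ⟩
        ≡⟨ cong (λ p → 2ⁱ ℤ.* ⟨ g ∣ ppow p (suc e) ⟩) (sym (restrict-S-below o i<n (IH i<n))) ⟩
      2ⁱ ℤ.* ⟨ g ∣ ppow (restrict k (S i)) (suc e) ⟩
        ≡⟨ cong (2ⁱ ℤ.*_) (sym (pairing-restrict-ppow (S i) (suc e))) ⟩
      2ⁱ ℤ.* ⟨ g ⇂ k ∣ ppow (S i) (suc e) ⟩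
        ≡⟨ cong (λ d′ → 2ⁱ ℤ.* ⟨ g ⇂ k ∣ ppow (S i) d′ ⟩) (sym d≡1+e) ⟩
      2ⁱ ℤ.* ⟨ g ⇂ k ∣ ppow (S i) d ⟩
        ≡⟨ cong (λ p → 2ⁱ ℤ.* ⟨ g ⇂ k ∣ ppow p d ⟩) (sym (nth-SList i<n)) ⟩
      2ⁱ ℤ.* ⟨ g ⇂ k ∣ ppow (nth (SList n) i) d ⟩
        ≡⟨ sym (pairing-pscale (g ⇂ k) 2ⁱ (ppow (nth (SList n) i) d)) ⟩
      ⟨ g ⇂ k ∣ corrTerm n i ⟩ ∎
      where
      open ≡-Reasoning
      2ⁱ : ℤ
      2ⁱ = + (2 ℕ.^ i)
      d : ℕ
      d = 2 ℕ.^ (n ∸ i)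

    ghost-top : ⟨ g ⇂ k ∣ ghostTerm n n ⟩ ≡ ⟨ g ∣ twoTerms (varMono (var X n)) (varMono (var Y n)) (+ (2 ℕ.^ n)) ⟩
    ghost-top rewrite ℕP.n∸n≡0 n =
      trans (pairing-pscale (g ⇂ k) (+ (2 ℕ.^ n)) (padd (ppow (pX n) 1) (ppow (pY n) 1)))
      (trans (cong (λ r → + (2 ℕ.^ n) ℤ.* r)
        (trans (pairing-padd (g ⇂ k) (ppow (pX n) 1) (ppow (pY n) 1))
               (cong₂ ℤ._+_ (trans (pairing-eq (ppow-one (pX n)) (g ⇂ k)) (cong (λ b → + 1 ℤ.* b ℤ.+ + 0) (kept X)))
                            (trans (pairing-eq (ppow-one (pY n)) (g ⇂ k)) (cong (λ b → + 1 ℤ.* b ℤ.+ + 0) (kept Y))))))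
      (distrib (+ (2 ℕ.^ n)) _ _))
      where
      kept : ∀ o′ → (g ⇂ k) (varMono (var o′ n)) ≡ g (varMono (var o′ n))
      kept o′ rewrite avoidsBelow-var o n (var o′ n) (λ j<n → var-below o o′ j<n) = refl
      distrib : ∀ a x y →
        a ℤ.* ((+ 1 ℤ.* x ℤ.+ + 0) ℤ.+ (+ 1 ℤ.* y ℤ.+ + 0)) ≡ a ℤ.* x ℤ.+ (a ℤ.* y ℤ.+ + 0)
      distrib = solve-∀

    restricted-ghostDiff :
      ⟨ g ∣ restrict k (ghostDiff n) ⟩ ≡ ⟨ g ∣ twoTerms (varMono (var X n)) (varMono (var Y n)) (+ (2 ℕ.^ n)) ⟩
    restricted-ghostDiff = begin
      ⟨ g ∣ restrict k (ghostDiff n) ⟩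
        ≡⟨ pairing-restrict g k (ghostDiff n) ⟩
      ⟨ g ⇂ k ∣ ghostDiff n ⟩
        ≡⟨ pairing-psub (g ⇂ k) (ghostXY n) (psum (map (corrTerm n) (upTo n))) ⟩
      ⟨ g ⇂ k ∣ ghostXY n ⟩ ℤ.+ ℤ.- (+ 1) ℤ.* ⟨ g ⇂ k ∣ psum (map (corrTerm n) (upTo n)) ⟩
        ≡⟨ cong₂ (λ a b → a ℤ.+ ℤ.- (+ 1) ℤ.* b) (pairing-psum-upTo (g ⇂ k) (ghostTerm n) (suc n))
                                                   (pairing-psum-upTo (g ⇂ k) (corrTerm n) n) ⟩
      sumTo G n ℤ.+ G n ℤ.+ ℤ.- (+ 1) ℤ.* sumTo C n
        ≡⟨ cong (λ b → sumTo G n ℤ.+ G n ℤ.+ ℤ.- (+ 1) ℤ.* b) (sym (sumTo-cong n terms-agree)) ⟩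
      sumTo G n ℤ.+ G n ℤ.+ ℤ.- (+ 1) ℤ.* sumTo G n
        ≡⟨ cancel (sumTo G n) (G n) ⟩
      G n
        ≡⟨ ghost-top ⟩
      ⟨ g ∣ twoTerms (varMono (var X n)) (varMono (var Y n)) (+ (2 ℕ.^ n)) ⟩ ∎
      where
      open ≡-Reasoning
      G C : ℕ → ℤ
      G i = ⟨ g ⇂ k ∣ ghostTerm n i ⟩
      C i = ⟨ g ⇂ k ∣ corrTerm n i ⟩
      sumTo-cong : ∀ m → (∀ i → i < m → G i ≡ C i) → sumTo G m ≡ sumTo C m
      sumTo-cong zero    _ = refl
      sumTo-cong (suc m) h = cong₂ ℤ._+_ (sumTo-cong m (λ i i<m → h i (ℕP.m<n⇒m<1+n i<m))) (h m ℕP.≤-refl)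
      cancel : ∀ a t → a ℤ.+ t ℤ.+ ℤ.- (+ 1) ℤ.* a ≡ t
      cancel = solve-∀

  -- the theorem on S_n, by strong induction; the pairing identity pins down the normal
  -- form restrict k (ghostDiff n) exactly, and dividing it by 2ⁿ gives X_n + Y_n
  S-restricted : ∀ o n → Restricted o n
  S-restricted o = <-rec (Restricted o) step
    where
    step : ∀ n → (∀ {i} → i < n → Restricted o i) → Restricted o n
    step n IH = subst (IsTwoTerms _ _ (+ 1)) (sym restrict-S)
      (pdiv2^-twoTerms _ _ X≢Y n (restrict k (ghostDiff n)) (restrict-NF k (ghostDiff n) ghostDiff-NF)
                       (λ m → Step.restricted-ghostDiff o n IH (δ m)))
      where
      k : Mono → Bool
      k = avoidsBelow o n
      ghostDiff-NF : NF (ghostDiff n)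
      ghostDiff-NF = norm-NF (ghostXY n ++ pscale (ℤ.- (+ 1)) (psum (map (corrTerm n) (upTo n))))
      X≢Y : ¬ varMono (var X n) ≡ varMono (var Y n)
      X≢Y e = ℕP.<⇒≢ (ℕP.n<1+n (2 ℕ.* n)) (varMono-injective _ _ e)
      restrict-S : restrict k (S n) ≡ pdiv2^ n (restrict k (ghostDiff n))
      restrict-S = trans (cong (restrict k) (S-ghost n)) (restrict-pdiv2^ k n (ghostDiff n))

-- Evaluating S_n at vectors
-- x , y whose first n components x₀,…,x_{n-1} (or y₀,…,y_{n-1}) vanish kills every
-- monomial deleted by the restriction of the previous module, so the n-th component of
-- x + y is x_n + y_n.
module WittVectorAddition {c ℓ} (K : CommutativeRing c ℓ) where
  open Restriction
  open NormalForms
  open WittAdditionPolynomials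
  open CommutativeRing K
  open OverRing K
  open import Relation.Binary.Reasoning.Setoid setoid

  ≡⇒≈ : ∀ {a b} → a ≡ b → a ≈ b
  ≡⇒≈ ≡.refl = refl

  evalMono-vanishes : ∀ t m env → avoids t m ≡ false → env t ≈ 0# → evalMono m env ≈ 0#
  evalMono-vanishes zero    (suc e ∷ es) env _ env₀≈0 = begin
    (env 0 * (env 0 ^K e)) * evalMono es (λ k → env (suc k)) ≈⟨ *-congʳ (*-congʳ env₀≈0) ⟩
    (0# * (env 0 ^K e)) * evalMono es (λ k → env (suc k))    ≈⟨ *-congʳ (zeroˡ _) ⟩
    0# * evalMono es (λ k → env (suc k))                     ≈⟨ zeroˡ _ ⟩
    0#                                                       ∎
  evalMono-vanishes (suc t) (e ∷ es) env h envₜ≈0 = begin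
    (env 0 ^K e) * evalMono es (λ k → env (suc k))
      ≈⟨ *-congˡ (evalMono-vanishes t es (λ k → env (suc k)) h envₜ≈0) ⟩
    (env 0 ^K e) * 0#                              ≈⟨ zeroʳ _ ⟩
    0#                                             ∎

  evalPoly-restrict : ∀ k env p → (∀ m → k m ≡ false → evalMono m env ≈ 0#) →
    evalPoly p env ≈ evalPoly (restrict k p) env
  evalPoly-restrict k env []            h = refl
  evalPoly-restrict k env ((m , a) ∷ p) h with k m in km
  ... | true  = +-congˡ (evalPoly-restrict k env p h)
  ... | false = begin
    fromℤ a * evalMono m env + evalPoly p env ≈⟨ +-congʳ (*-congˡ (h m km)) ⟩
    fromℤ a * 0# + evalPoly p env             ≈⟨ +-congʳ (zeroʳ _) ⟩
    0# + evalPoly p env                       ≈⟨ +-identityˡ _ ⟩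
    evalPoly p env                            ≈⟨ evalPoly-restrict k env p h ⟩
    evalPoly (restrict k p) env               ∎

  avoidsBelow-false : ∀ o n m → avoidsBelow o n m ≡ false → Σ ℕ λ j → j < n × avoids (var o j) m ≡ false
  avoidsBelow-false o (suc n) m e with avoidsBelow o n m in e′
  ... | true  = n , ℕP.≤-refl , e
  ... | false with avoidsBelow-false o n m e′
  ...   | j , j<n , a = j , ℕP.m<n⇒m<1+n j<n , a

  evalMono-var : ∀ t env → evalMono (varMono t) env ≈ env t
  evalMono-var zero    env = trans (*-identityʳ _) (*-identityʳ _)
  evalMono-var (suc t) env = trans (*-identityˡ _) (evalMono-var t (λ k → env (suc k)))

  evalPoly-IsTwoTerms : ∀ a b P env → IsTwoTerms (varMono a) (varMono b) (+ 1) P → evalPoly P env ≈ env a + env b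
  evalPoly-IsTwoTerms a b _ env (inj₁ ≡.refl) = sum-of-vars a b
    where
    sum-of-vars : ∀ a b → evalPoly (twoTerms (varMono a) (varMono b) (+ 1)) env ≈ env a + env b
    sum-of-vars a b = begin
      fromℤ (+ 1) * evalMono (varMono a) env + (fromℤ (+ 1) * evalMono (varMono b) env + 0#)
        ≈⟨ +-cong (*-cong (+-identityʳ 1#) (evalMono-var a env))
                  (trans (+-identityʳ _) (*-cong (+-identityʳ 1#) (evalMono-var b env))) ⟩
      1# * env a + 1# * env b ≈⟨ +-cong (*-identityˡ _) (*-identityˡ _) ⟩
      env a + env b ∎
  evalPoly-IsTwoTerms a b _ env (inj₂ ≡.refl) = trans (evalPoly-IsTwoTerms b a _ env (inj₁ ≡.refl)) (+-comm _ _)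

  sideValues : Side → (ℕ → Carrier) → (ℕ → Carrier) → ℕ → Carrier
  sideValues X f g = f
  sideValues Y f g = g

  envXY-var : ∀ o f g i → envXY f g (var o i) ≡ sideValues o f g i
  envXY-var X f g zero    = ≡.refl
  envXY-var Y f g zero    = ≡.refl
  envXY-var X f g (suc i) =
    ≡.trans (≡.cong (envXY f g) (ℕP.*-suc 2 i)) (envXY-var X (λ k → f (suc k)) (λ k → g (suc k)) i)
  envXY-var Y f g (suc i) =
    ≡.trans (≡.cong (λ t → envXY f g (suc t)) (ℕP.*-suc 2 i)) (envXY-var Y (λ k → f (suc k)) (λ k → g (suc k)) i)

  evalPoly-S : ∀ o n f g → (∀ i → i < n → sideValues o f g i ≈ 0#) → evalPoly (S n) (envXY f g) ≈ f n + g n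
  evalPoly-S o n f g vanish = begin
    evalPoly (S n) (envXY f g)
      ≈⟨ evalPoly-restrict (avoidsBelow o n) _ (S n) rejected ⟩
    evalPoly (restrict (avoidsBelow o n) (S n)) (envXY f g)
      ≈⟨ evalPoly-IsTwoTerms (var X n) (var Y n) _ (envXY f g) (S-restricted o n) ⟩
    envXY f g (var X n) + envXY f g (var Y n)
      ≈⟨ +-cong (≡⇒≈ (envXY-var X f g n)) (≡⇒≈ (envXY-var Y f g n)) ⟩
    f n + g n ∎
    where
    rejected : ∀ m → avoidsBelow o n m ≡ false → evalMono m (envXY f g) ≈ 0#
    rejected m e with avoidsBelow-false o n m e
    ... | j , j<n , a = evalMono-vanishes (var o j) m (envXY f g) a (trans (≡⇒≈ (envXY-var o f g j)) (vanish j j<n))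

  VanishesBelow : ∀ {s} → W s → ℕ → Set ℓ
  VanishesBelow x j = ∀ i → i < j → at x i ≈ 0#

  -- +W is defined with `at`, the filtrations with `lookup`
  at-lookup : ∀ {s} (x : W s) j → at x (toℕ j) ≡ lookup x j
  at-lookup (x ∷ xs) Fin.zero    = ≡.refl
  at-lookup (x ∷ xs) (Fin.suc j) = at-lookup xs j

  +W-lookup : ∀ {s} (x y : W s) j → VanishesBelow x (toℕ j) ⊎ VanishesBelow y (toℕ j) →
    lookup (x +W y) j ≈ lookup x j + lookup y j
  +W-lookup x y j vanish = begin
    lookup (x +W y) j                          ≡⟨ VecP.lookup∘tabulate _ j ⟩
    evalPoly (S (toℕ j)) (envXY (at x) (at y)) ≈⟨ S-value vanish ⟩
    at x (toℕ j) + at y (toℕ j)                ≈⟨ +-cong (≡⇒≈ (at-lookup x j)) (≡⇒≈ (at-lookup y j)) ⟩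
    lookup x j + lookup y j                    ∎
    where
    S-value : VanishesBelow x (toℕ j) ⊎ VanishesBelow y (toℕ j) →
      evalPoly (S (toℕ j)) (envXY (at x) (at y)) ≈ at x (toℕ j) + at y (toℕ j)
    S-value (inj₁ x-vanishes) = evalPoly-S X (toℕ j) (at x) (at y) x-vanishes
    S-value (inj₂ y-vanishes) = evalPoly-S Y (toℕ j) (at x) (at y) y-vanishes

module WittVectors {c ℓ} (K : CommutativeRing c ℓ) where
  open CommutativeRing K
  open OverRing K
  open WittVectorAddition K
  open import Relation.Binary.Reasoning.Setoid setoid

  ≋-intro : ∀ {s} {x y : W s} → (∀ j → lookup x j ≈ lookup y j) → x ≋ y
  ≋-intro h = Extensional.extensional⇒inductive (Extensional.ext h)

  ≋-refl : ∀ {s} {x : W s} → x ≋ x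
  ≋-refl = Pointwise.refl refl

  ≋-sym : ∀ {s} {x y : W s} → x ≋ y → y ≋ x
  ≋-sym = Pointwise.sym sym

  ≋-trans : ∀ {s} {x y z : W s} → x ≋ y → y ≋ z → x ≋ z
  ≋-trans = Pointwise.trans trans

  zeroW : ∀ s → W s
  zeroW s = Vec.replicate s 0#

  at-zeroW : ∀ s i → at (zeroW s) i ≡ 0#
  at-zeroW zero    i       = ≡.refl
  at-zeroW (suc s) zero    = ≡.refl
  at-zeroW (suc s) (suc i) = at-zeroW s i

  +W-vanishingʳ : ∀ {s} (x z : W s) → (∀ i → at z i ≈ 0#) → (x +W z) ≋ x
  +W-vanishingʳ x z z≈0 = ≋-intro λ j → begin
    lookup (x +W z) j       ≈⟨ +W-lookup x z j (inj₂ (λ i _ → z≈0 i)) ⟩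
    lookup x j + lookup z j ≈⟨ +-congˡ (trans (≡⇒≈ (≡.sym (at-lookup z j))) (z≈0 (toℕ j))) ⟩
    lookup x j + 0#         ≈⟨ +-identityʳ _ ⟩
    lookup x j              ∎

  +W-vanishingˡ : ∀ {s} (z x : W s) → (∀ i → at z i ≈ 0#) → (z +W x) ≋ x
  +W-vanishingˡ z x z≈0 = ≋-intro λ j → begin
    lookup (z +W x) j       ≈⟨ +W-lookup z x j (inj₁ (λ i _ → z≈0 i)) ⟩
    lookup z j + lookup x j ≈⟨ +-congʳ (trans (≡⇒≈ (≡.sym (at-lookup z j))) (z≈0 (toℕ j))) ⟩
    0# + lookup x j         ≈⟨ +-identityˡ _ ⟩
    lookup x j              ∎

  at-cast : ∀ {m k} .(eq : m ≡ k) (v : W m) i → at (Vec.cast eq v) i ≡ at v i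
  at-cast {k = zero}  eq []       i       = ≡.refl
  at-cast {k = suc k} eq (x ∷ xs) zero    = ≡.refl
  at-cast {k = suc k} eq (x ∷ xs) (suc i) = at-cast (ℕP.suc-injective eq) xs i

  at-Vpow-below : ∀ t {s} (v : W s) i → i < t → at (Vpow t v) i ≡ 0#
  at-Vpow-below (suc t) v zero    _         = ≡.refl
  at-Vpow-below (suc t) v (suc i) (s≤s i<t) = at-Vpow-below t v i i<t

  at-Vpow-shift : ∀ t {s} (v : W s) i → at (Vpow t v) (t ℕ.+ i) ≡ at v i
  at-Vpow-shift zero    v i = ≡.refl
  at-Vpow-shift (suc t) v i = at-Vpow-shift t v i

  at-Vpow-empty : ∀ t i → at (Vpow t []) i ≡ 0#
  at-Vpow-empty zero    i       = ≡.refl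
  at-Vpow-empty (suc t) zero    = ≡.refl
  at-Vpow-empty (suc t) (suc i) = at-Vpow-empty t i

  at-Vto-empty : ∀ {s} h i → at (Vto 0 s h []) i ≡ 0#
  at-Vto-empty {s} h i = ≡.trans (at-cast (ℕP.m∸n+n≡m h) (Vpow s []) i) (at-Vpow-empty s i)

  -- V^n : K = W₁ → W_{n+1}  (the proof of 1 ≤ n + 1 is irrelevant for Vto)
  Vtop : ∀ n → W 1 → W (suc n)
  Vtop n = Vto 1 (suc n) (s≤s z≤n)

  at-V-below : ∀ n (a : W 1) i → i < n → at (Vtop n a) i ≡ 0#
  at-V-below n a i i<n = ≡.trans (at-cast (ℕP.m∸n+n≡m (s≤s (z≤n {n}))) (Vpow n a) i) (at-Vpow-below n a i i<n)

  at-V-top : ∀ n (a : W 1) → at (Vtop n a) n ≡ at a 0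
  at-V-top n a =
    ≡.trans (at-cast (ℕP.m∸n+n≡m (s≤s (z≤n {n}))) (Vpow n a) n)
    (≡.trans (≡.cong (at (Vpow n a)) (≡.sym (ℕP.+-identityʳ n))) (at-Vpow-shift n a 0))

  V-vanishes : ∀ n (a : W 1) (j : Fin (suc n)) → VanishesBelow (Vtop n a) (toℕ j)
  V-vanishes n a j i i<j = ≡⇒≈ (at-V-below n a i (ℕP.<-≤-trans i<j (ℕ.s≤s⁻¹ (FinP.toℕ<n j))))

  data Position {n} : Fin (suc n) → Set where
    below : ∀ {j} → toℕ j < n → Position j
    top   : Position (Fin.fromℕ n)

  position : ∀ {n} (j : Fin (suc n)) → Position j
  position {n} j with ℕP.m≤n⇒m<n∨m≡n (ℕ.s≤s⁻¹ (FinP.toℕ<n j))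
  ... | inj₁ j<n = below j<n
  ... | inj₂ j≡n rewrite FinP.toℕ-injective (≡.trans j≡n (≡.sym (FinP.toℕ-fromℕ n))) = top

  lookup-V-below : ∀ n (a : W 1) {j : Fin (suc n)} → toℕ j < n → lookup (Vtop n a) j ≈ 0#
  lookup-V-below n a {j} j<n = ≡⇒≈ (≡.trans (≡.sym (at-lookup (Vtop n a) j)) (at-V-below n a (toℕ j) j<n))

  lookup-V-top : ∀ n (a : W 1) → lookup (Vtop n a) (Fin.fromℕ n) ≈ lookup a Fin.zero
  lookup-V-top n a =
    ≡⇒≈ (≡.trans (≡.sym (at-lookup (Vtop n a) (Fin.fromℕ n)))
        (≡.trans (≡.cong (at (Vtop n a)) (FinP.toℕ-fromℕ n))
        (≡.trans (at-V-top n a) (at-lookup a Fin.zero))))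

  +W-Vˡ : ∀ n (a : W 1) (y : W (suc n)) j → lookup (Vtop n a +W y) j ≈ lookup (Vtop n a) j + lookup y j
  +W-Vˡ n a y j = +W-lookup (Vtop n a) y j (inj₁ (V-vanishes n a j))

  +W-Vʳ : ∀ n (a : W 1) (y : W (suc n)) j → lookup (y +W Vtop n a) j ≈ lookup y j + lookup (Vtop n a) j
  +W-Vʳ n a y j = +W-lookup y (Vtop n a) j (inj₂ (V-vanishes n a j))

  +W₁ : ∀ (a b : W 1) → lookup (a +W b) Fin.zero ≈ lookup a Fin.zero + lookup b Fin.zero
  +W₁ a b = +W-lookup a b Fin.zero (inj₁ (λ i ()))

module FiltrationFacts {c ℓ} (K : CommutativeRing c ℓ) (ord : CommutativeRing.Carrier K → Maybe ℤ)
                       (val : OverRing.IsNormalizedDiscreteValuation K ord) where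
  open CommutativeRing K
  open OverRing K
  open Filtrations ord
  open IsNormalizedDiscreteValuation val
  open WittVectorAddition K
  open WittVectors K

  scaled≥-zero : ∀ {x} → x ≈ 0# → ∀ w N → scaled≥ w (ord x) N
  scaled≥-zero {x} x≈0 w N rewrite ord-0⇒∞ x x≈0 = tt

  scaled≥-resp : ∀ {x y} w N → x ≈ y → scaled≥ w (ord x) N → scaled≥ w (ord y) N
  scaled≥-resp w N x≈y h rewrite ord-cong x≈y = h

  scaled≥-weaken : ∀ w o {N N′} → N′ ℤ.≤ N → scaled≥ w o N → scaled≥ w o N′
  scaled≥-weaken w nothing  N′≤N h = tt
  scaled≥-weaken w (just k) N′≤N h = ℤP.≤-trans N′≤N h

  scaled≥-+ : ∀ x y N → scaled≥ 1 (ord x) N → scaled≥ 1 (ord y) N → scaled≥ 1 (ord (x + y)) N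
  scaled≥-+ x y N hx hy = above-min (ord x) (ord y) (ord (x + y)) hx hy (ord-add x y)
    where
    at-weight-1 : ∀ k → N ℤ.≤ + 1 ℤ.* k → N ℤ.≤ k
    at-weight-1 k = ≡.subst (N ℤ.≤_) (ℤP.*-identityˡ k)
    above-min : ∀ o₁ o₂ o → scaled≥ 1 o₁ N → scaled≥ 1 o₂ N → min∞ o₁ o₂ ≤∞ o → scaled≥ 1 o N
    above-min o₁ o₂ nothing _ _ _ = tt
    above-min nothing (just b) (just k) _ h₂ b≤k =
      ≡.subst (N ℤ.≤_) (≡.sym (ℤP.*-identityˡ k)) (ℤP.≤-trans (at-weight-1 b h₂) b≤k)
    above-min (just a) nothing (just k) h₁ _ a≤k =
      ≡.subst (N ℤ.≤_) (≡.sym (ℤP.*-identityˡ k)) (ℤP.≤-trans (at-weight-1 a h₁) a≤k)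
    above-min (just a) (just b) (just k) h₁ h₂ a⊓b≤k =
      ≡.subst (N ℤ.≤_) (≡.sym (ℤP.*-identityˡ k))
        (ℤP.≤-trans (ℤP.⊓-glb (at-weight-1 a h₁) (at-weight-1 b h₂)) a⊓b≤k)

  scaled≥-integral : ∀ w o → 2 ≤ w → scaled≥ w o -[1+ 0 ] → scaled≥ w o (+ 0)
  scaled≥-integral w nothing _ _ = tt
  scaled≥-integral w (just (+ t)) _ _ rewrite ≡.sym (ℤP.pos-* w t) = ℤ.+≤+ z≤n
  scaled≥-integral (suc zero) (just -[1+ t ]) (s≤s ()) _
  scaled≥-integral (suc (suc w)) (just -[1+ t ]) _ (ℤ.-≤- p) = ⊥-elim (ℕP.m+1+n≢0 t (ℕP.n≤0⇒n≡0 p))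

  Fil-resp : ∀ {s} N {x y : W s} → x ≋ y → Fil N x → Fil N y
  Fil-resp N x≋y h j = scaled≥-resp _ _ (Pointwise.lookup x≋y j) (h j)

  Fil-zero : ∀ s N → Fil N (zeroW s)
  Fil-zero s N j = scaled≥-zero (≡⇒≈ (VecP.lookup-replicate j 0#)) _ _

  -- fil'_1 W_s = fil_0 W_s : its V-part is V^s applied to W₀ = 0, which is zero
  Fil′₁-intro : ∀ {s} (x : W s) → Fil (+ 0) x → Fil′ 1 x
  Fil′₁-intro {s} x h =
    x , [] , h , (λ ()) , ≋-sym (+W-vanishingʳ x (Vto 0 s z≤n []) (λ i → ≡⇒≈ (at-Vto-empty {s} z≤n i)))

  Fil′₁-elim : ∀ {s} (x : W s) → Fil′ 1 x → Fil (+ 0) x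
  Fil′₁-elim {s} x (y , [] , fy , _ , x≋y+0) =
    Fil-resp (+ 0) (≋-sym (≋-trans x≋y+0 (+W-vanishingʳ y (Vto 0 s z≤n []) (λ i → ≡⇒≈ (at-Vto-empty {s} z≤n i)))))
             fy

  Fil₁-intro : ∀ {N a} → scaled≥ 1 (ord a) (ℤ.- N) → Fil N (a ∷ [])
  Fil₁-intro h Fin.zero = h

module GradedPieceTwo {c ℓ} (K : CommutativeRing c ℓ) (ord : CommutativeRing.Carrier K → Maybe ℤ)
                      (val : OverRing.IsNormalizedDiscreteValuation K ord) (n : ℕ) where
  open CommutativeRing K
  open OverRing K
  open Filtrations ord
  open WittVectorAddition K
  open WittVectors K
  open FiltrationFacts K ord val
  open import Relation.Binary.Reasoning.Setoid setoid

  f : W 1 → W (suc n)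
  f = Vtop n

  topIx : Fin (suc n)
  topIx = Fin.fromℕ n

  top-exponent : n ∸ toℕ topIx ≡ 0
  top-exponent = ≡.trans (≡.cong (n ∸_) (FinP.toℕ-fromℕ n)) (ℕP.n∸n≡0 n)

  Fil-top : ∀ {N} (y : W (suc n)) → Fil N y → scaled≥ 1 (ord (lookup y topIx)) (ℤ.- N)
  Fil-top {N} y h = ≡.subst (λ e → scaled≥ (2 ℕ.^ e) (ord (lookup y topIx)) (ℤ.- N)) top-exponent (h topIx)

  top-Fil : ∀ {N} (y : W (suc n)) → scaled≥ 1 (ord (lookup y topIx)) (ℤ.- N) →
    scaled≥ (2 ℕ.^ (n ∸ toℕ topIx)) (ord (lookup y topIx)) (ℤ.- N)
  top-Fil {N} y = ≡.subst (λ e → scaled≥ (2 ℕ.^ e) (ord (lookup y topIx)) (ℤ.- N)) (≡.sym top-exponent)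

  weight-below : ∀ {j : Fin (suc n)} → toℕ j < n → 2 ≤ 2 ℕ.^ (n ∸ toℕ j)
  weight-below {j} j<n with n ∸ toℕ j | ℕP.m<n⇒0<n∸m j<n
  ... | suc k | _ = ℕP.*-monoʳ-≤ 2 (ℕP.m^n>0 2 k)

  Fil-f : ∀ {N} a → Fil N a → Fil N (f a)
  Fil-f {N} a h j with position j
  ... | below j<n = scaled≥-zero (lookup-V-below n a j<n) _ _
  ... | top       = top-Fil {N} (f a) (scaled≥-resp 1 _ (sym (lookup-V-top n a)) (h Fin.zero))

  f-cong : ∀ {a b} → a ≋ b → f a ≋ f b
  f-cong {a} {b} a≋b = ≋-intro λ j → lookup-f j (position j)
    where
    lookup-f : ∀ j → Position j → lookup (f a) j ≈ lookup (f b) j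
    lookup-f j (below j<n) = trans (lookup-V-below n a j<n) (sym (lookup-V-below n b j<n))
    lookup-f _ top = trans (lookup-V-top n a) (trans (Pointwise.lookup a≋b Fin.zero) (sym (lookup-V-top n b)))

  f-+ : ∀ a b → f (a +W b) ≋ (f a +W f b)
  f-+ a b = ≋-intro λ j → trans (lookup-f j (position j)) (sym (+W-Vˡ n a (f b) j))
    where
    lookup-f : ∀ j → Position j → lookup (f (a +W b)) j ≈ lookup (f a) j + lookup (f b) j
    lookup-f j (below j<n) = begin
      lookup (f (a +W b)) j      ≈⟨ lookup-V-below n (a +W b) j<n ⟩
      0#                         ≈⟨ sym (+-identityʳ 0#) ⟩
      0# + 0#                    ≈⟨ sym (+-cong (lookup-V-below n a j<n) (lookup-V-below n b j<n)) ⟩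
      lookup (f a) j + lookup (f b) j ∎
    lookup-f _ top = begin
      lookup (f (a +W b)) topIx                  ≈⟨ lookup-V-top n (a +W b) ⟩
      lookup (a +W b) Fin.zero                   ≈⟨ +W₁ a b ⟩
      lookup a Fin.zero + lookup b Fin.zero      ≈⟨ sym (+-cong (lookup-V-top n a) (lookup-V-top n b)) ⟩
      lookup (f a) topIx + lookup (f b) topIx    ∎

  Fil′₂-K : ∀ (a : W 1) → Fil′ 2 a → Fil (+ 2) a
  Fil′₂-K (a ∷ []) (y , (z ∷ []) , fy , fz , a≋y+z) =
    Fil₁-intro (scaled≥-resp 1 _ (sym a≈y+z)
      (scaled≥-+ _ z _ (scaled≥-weaken 1 _ (ℤ.-≤- z≤n) (fy Fin.zero)) (fz Fin.zero)))
    where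
    a≈y+z : a ≈ lookup y Fin.zero + z
    a≈y+z = trans (Pointwise.lookup a≋y+z Fin.zero) (+W₁ y (z ∷ []))

  lowerComponent : W (suc n) → ∀ j → Position j → Carrier
  lowerComponent y j (below _) = lookup y j
  lowerComponent y _ top       = 0#

  lower : W (suc n) → W (suc n)
  lower y = tabulate λ j → lowerComponent y j (position j)

  lower-below : ∀ y {j} → toℕ j < n → lookup (lower y) j ≡ lookup y j
  lower-below y {j} j<n rewrite VecP.lookup∘tabulate (λ j → lowerComponent y j (position j)) j with position j
  ... | below _ = ≡.refl
  ... | top     = ⊥-elim (ℕP.<⇒≢ j<n (FinP.toℕ-fromℕ n))

  lower-top : ∀ y → lookup (lower y) topIx ≡ 0#
  lower-top y rewrite VecP.lookup∘tabulate (λ j → lowerComponent y j (position j)) topIx with position topIx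
  ... | below j<n = ⊥-elim (ℕP.<⇒≢ j<n (FinP.toℕ-fromℕ n))
  ... | top       = ≡.refl

  Fil-lower : ∀ y → Fil (+ 1) y → Fil (+ 0) (lower y)
  Fil-lower y h j with position j
  ... | below j<n = scaled≥-resp _ _ (≡⇒≈ (≡.sym (lower-below y j<n)))
                      (scaled≥-integral _ _ (weight-below j<n) (h j))
  ... | top       = scaled≥-zero (≡⇒≈ (lower-top y)) _ _

  maps-fil : ∀ a → Fil′ 2 a → Fil′ 2 (f a)
  maps-fil a fa =
    zeroW (suc n) , a , Fil-zero (suc n) _ , Fil′₂-K a fa ,
    ≋-sym (+W-vanishingˡ (zeroW (suc n)) (f a) (λ i → ≡⇒≈ (at-zeroW (suc n) i)))

  well-defined : ∀ a a′ → Fil′ 2 a → Fil′ 2 a′ → CongMod 1 a a′ → CongMod 1 (f a) (f a′)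
  well-defined a a′ _ _ (b , fb , a′≋a+b) =
    f b , Fil′₁-intro (f b) (Fil-f {+ 0} b (Fil′₁-elim b fb)) , ≋-trans (f-cong a′≋a+b) (f-+ a b)

  additive : ∀ a a′ → Fil′ 2 a → Fil′ 2 a′ → CongMod 1 (f (a +W a′)) (f a +W f a′)
  additive a a′ _ _ =
    zeroW (suc n) , Fil′₁-intro (zeroW (suc n)) (Fil-zero (suc n) (+ 0)) ,
    ≋-trans (≋-sym (f-+ a a′))
            (≋-sym (+W-vanishingʳ (f (a +W a′)) (zeroW (suc n)) (λ i → ≡⇒≈ (at-zeroW (suc n) i))))

  -- f a′ ≡ f a mod fil_0 compares the top components
  injective : ∀ a a′ → Fil′ 2 a → Fil′ 2 a′ → CongMod 1 (f a) (f a′) → CongMod 1 a a′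
  injective a a′ _ _ (B , fB , fa′≋fa+B) =
    (lookup B topIx ∷ []) ,
    Fil′₁-intro (lookup B topIx ∷ []) (Fil₁-intro {+ 0} (Fil-top {+ 0} B (Fil′₁-elim B fB))) ,
    ≋-intro λ { Fin.zero → a′≈a+Btop }
    where
    a′≈a+Btop : lookup a′ Fin.zero ≈ lookup (a +W (lookup B topIx ∷ [])) Fin.zero
    a′≈a+Btop = begin
      lookup a′ Fin.zero                 ≈⟨ sym (lookup-V-top n a′) ⟩
      lookup (f a′) topIx                ≈⟨ Pointwise.lookup fa′≋fa+B topIx ⟩
      lookup (f a +W B) topIx            ≈⟨ +W-Vˡ n a B topIx ⟩
      lookup (f a) topIx + lookup B topIx ≈⟨ +-congʳ (lookup-V-top n a) ⟩
      lookup a Fin.zero + lookup B topIx ≈⟨ sym (+W₁ a (lookup B topIx ∷ [])) ⟩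
      lookup (a +W (lookup B topIx ∷ [])) Fin.zero ∎

  -- x = y + V^n z is congruent mod fil_0 to f (y_top + z)
  surjective : ∀ x → Fil′ 2 x → Σ (W 1) λ a → Fil′ 2 a × CongMod 1 (f a) x
  surjective x (y , (z₀ ∷ []) , fy , fz , x≋y+fz) =
    a , ((ytop ∷ []) , z , Fil₁-intro {+ 1} (Fil-top y fy) , fz , ≋-refl) ,
    (lower y , Fil′₁-intro (lower y) (Fil-lower y fy) , ≋-intro λ j → component j (position j))
    where
    z : W 1
    z = z₀ ∷ []
    ytop : Carrier
    ytop = lookup y topIx
    a : W 1
    a = (ytop ∷ []) +W z
    component : ∀ j → Position j → lookup x j ≈ lookup (f a +W lower y) j
    component j (below j<n) = begin
      lookup x j                         ≈⟨ Pointwise.lookup x≋y+fz j ⟩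
      lookup (y +W f z) j                ≈⟨ +W-Vʳ n z y j ⟩
      lookup y j + lookup (f z) j        ≈⟨ +-congˡ (lookup-V-below n z j<n) ⟩
      lookup y j + 0#                    ≈⟨ +-comm _ _ ⟩
      0# + lookup y j                    ≈⟨ +-cong (sym (lookup-V-below n a j<n)) (≡⇒≈ (≡.sym (lower-below y j<n))) ⟩
      lookup (f a) j + lookup (lower y) j ≈⟨ sym (+W-Vˡ n a (lower y) j) ⟩
      lookup (f a +W lower y) j          ∎
    component _ top = begin
      lookup x topIx                     ≈⟨ Pointwise.lookup x≋y+fz topIx ⟩
      lookup (y +W f z) topIx            ≈⟨ +W-Vʳ n z y topIx ⟩
      ytop + lookup (f z) topIx          ≈⟨ +-congˡ (lookup-V-top n z) ⟩
      ytop + lookup z Fin.zero           ≈⟨ sym (+W₁ (ytop ∷ []) z) ⟩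
      lookup a Fin.zero                  ≈⟨ sym (+-identityʳ _) ⟩
      lookup a Fin.zero + 0#             ≈⟨ +-cong (sym (lookup-V-top n a)) (≡⇒≈ (≡.sym (lower-top y))) ⟩
      lookup (f a) topIx + lookup (lower y) topIx ≈⟨ sym (+W-Vˡ n a (lower y) topIx) ⟩
      lookup (f a +W lower y) topIx      ∎

-- Lemma 1.16.  The argument only uses the valuation axioms: Witt addition is given by
-- the universal integral polynomials S_n.
lemma1p16 : ∀ {c ℓ : Level} (K : CommutativeRing c ℓ)
            (ord : CommutativeRing.Carrier K → Maybe ℤ) →
            OverRing.IsField K →
            OverRing.CharTwo K →
            OverRing.IsNormalizedDiscreteValuation K ord →
            OverRing.IsComplete K ord →
            (s : ℕ) → (h : 1 ≤ s) →
            OverRing.Filtrations.InducesIsoOnGr′ K ord 2 (OverRing.Vto K 1 s h)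
lemma1p16 K ord _ _ val _ (suc n) (s≤s z≤n) = record
  { maps-fil     = maps-fil
  ; well-defined = well-defined
  ; additive     = additive
  ; injective    = injective
  ; surjective   = surjective
  }
  where open GradedPieceTwo K ord val n
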